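{- Let $\Bbbk$ be a field of characteristic zero, $\beta\in\Bbbk^\times$, and let $A$ be the $\Bbbk$-algebra generated by $x,y,z$ subject to $$yz-zy=0,\qquad zx-\beta xz=y,\qquad xy-yx=0.$$ Then: (1) For all $m,n\in\mathbb{N}$, $y^nx^m=x^my^n$, $z^ny^m=y^mz^n$, and $$z^nx^m=\sum_{k=0}^{\min\{m,n\}}\beta^{(m-k)(n-k)}\begin{bmatrix}n\\k\end{bmatrix}_\beta\begin{bmatrix}m\\k\end{bmatrix}_\beta[k]_\beta!\,x^{m-k}y^kz^{n-k}.$$ Equivalently, defining $W^{(m)}_{n,k}(y)\in\Bbbk[y]$ by $z^nx^m=\sum_{k=0}^{\min\{m,n\}}x^{m-k}W^{(m)}_{n,k}(y)z^{n-k}$, one has $W^{(m)}_{0,0}(y)=1$, $W^{(m)}_{0,k}(y)=0$ ($k\ge1$), and $W^{(m)}_{n+1,k}(y)=\beta^{m-k}W^{(m)}_{n,k}(y)+y[m-k+1]_\beta W^{(m)}_{n,k-1}(y)$ for $n,k\ge0$, with $W^{(m)}_{n,-1}(y):=0$. (2) For all $m,n,s\in\mathbb{N}$, $(x^ny^m)^s=x^{ns}y^{ms}$ and $(y^nz^m)^s=y^{ns}z^{ms}$. Moreover $(x^nz^m)^s=\sum_{\ell=0}^{\min\{ns,ms\}}x^{ns-\ell}U^{(n,m)}_{s,\ell}(y)z^{ms-\ell}$ uniquely with $U^{(n,m)}_{s,\ell}(y)\in\Bbbk[y]$, $U^{(n,m)}_{1,0}=1$, $U^{(n,m)}_{1,\ell}=0$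 ($\ell\ge1$), and $U^{(n,m)}_{s+1,\ell}(y)=\sum_{k=0}^{\min\{n,\ell\}}U^{(n,m)}_{s,\ell-k}(y)W^{(n)}_{ms-(\ell-k),k}(y)$ for $s\ge1,\ell\ge0$. (3) There exist unique $V_{s,\ell}(y)\in\Bbbk[y]$ ($0\le\ell\le s$) with $(xyz)^s=\sum_{\ell=0}^sx^{s-\ell}V_{s,\ell}(y)z^{s-\ell}$; $V_{1,0}(y)=y$, $V_{1,\ell}(y)=0$ ($\ell\ge1$), and $V_{s+1,\ell}(y)=\beta^{s-\ell}yV_{s,\ell}(y)+[s-\ell+1]_\beta y^2V_{s,\ell-1}(y)$ for $s\ge1,\ell\ge0$, with $V_{s,-1}(y):=0$. (4) For all $n,m,t,s\in\mathbb{N}$ and $0\le\ell\le\min\{ns,ts\}$ there exist unique $R^{(n,m,t)}_{s,\ell}(y)\in\Bbbk[y]$ with $(x^ny^mz^t)^s=\sum_{\ell=0}^{\min\{ns,ts\}}x^{ns-\ell}R^{(n,m,t)}_{s,\ell}(y)z^{ts-\ell}$; $R^{(n,m,t)}_{1,0}(y)=y^m$, $R^{(n,m,t)}_{1,\ell}(y)=0$ ($\ell\ge1$), and $R^{(n,m,t)}_{s+1,\ell}(y)=y^m\sum_{k=0}^{\min\{n,\ell\}}R^{(n,m,t)}_{s,\ell-k}(y)W^{(n)}_{ts-(\ell-k),k}(y)$ for $s\ge1,\ell\ge0$. (5) $(x+y)^n=\sum_{k=0}^n\binom nkx^{n-k}y^k$ and $(y+z)^n=\sum_{k=0}^n\binom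 nky^{n-k}z^k$. Finally $(x+z)^n=\sum_{i,k\ge0,\ i+k\le n}x^iE_{n;i,k}(y)z^k$ uniquely with $E_{n;i,k}(y)\in\Bbbk[y]$, $E_{0;0,0}=1$, $E_{0;i,k}=0$ for $(i,k)\ne(0,0)$, and $E_{n+1;i,k}(y)=E_{n;i,k-1}(y)+\beta^kE_{n;i-1,k}(y)+y[k+1]_\beta E_{n;i,k+1}(y)$, where $E_{n;i,k}(y)=0$ if $i<0$, $k<0$ or $i+k>n$.
   Context: $\mathbb{N}$ includes $0$. For $q\in\Bbbk^\times$: $[r]_q=1+q+\cdots+q^{r-1}$ ($[0]_q=0$), $[r]_q!=\prod_{j=1}^r[j]_q$ ($[0]_q!=1$), $\begin{bmatrix}r\\k\end{bmatrix}_q=\frac{[r]_q!}{[r-k]_q![k]_q!}$ for $0\le k\le r$ and $0$ if $k>r$. The standard monomials $x^iy^jz^k$ form a $\Bbbk$-basis of $A$ (PBW basis); uniqueness refers to expansions in this basis, with polynomials in $y$ placed between the $x$-power and the $z$-power. Coefficients with a negative index are zero; empty sums are $0$, empty products $1$. -}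

module Defs where

open import Level using (Level; _⊔_)
open import Algebra.Bundles using (CommutativeRing; Ring)
open import Data.Nat as ℕ using (ℕ; zero; suc; _∸_; _⊓_; _≤_; _<_)
open import Data.Nat.Combinatorics using (_C_)
open import Data.Product using (Σ; Σ-syntax; _×_; _,_)
open import Data.List using (List; []; _∷_)
open import Relation.Nullary using (¬_)

module _ {c ℓ} (K : CommutativeRing c ℓ) where
  open CommutativeRing K

  ℕ→ : ℕ → Carrier
  ℕ→ zero = 0#
  ℕ→ (suc n) = 1# + ℕ→ n

  record IsField : Set (c ⊔ ℓ) where
    field
      1≉0 : ¬ (1# ≈ 0#)
      inv : ∀ a → ¬ (a ≈ 0#) → Σ[ b ∈ Carrier ] (a * b ≈ 1#)

  CharZero : Set ℓ
  CharZero = ∀ n → ¬ (ℕ→ (suc n) ≈ 0#)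

  _^K_ : Carrier → ℕ → Carrier
  q ^K zero = 1#
  q ^K suc n = q * (q ^K n)

  qint : Carrier → ℕ → Carrier
  qint q zero = 0#
  qint q (suc r) = qint q r + q ^K r

  qfact : Carrier → ℕ → Carrier
  qfact q zero = 1#
  qfact q (suc r) = qfact q r * qint q (suc r)

  -- Gaussian binomial [r choose k]_q, i.e. the polynomial [r]_q!/([r-k]_q![k]_q!)
  -- in q (evaluated at q), given by q-Pascal; it is 0 for k > r.
  qbin : Carrier → ℕ → ℕ → Carrier
  qbin q r zero = 1#
  qbin q zero (suc k) = 0#
  qbin q (suc r) (suc k) = qbin q r k + (q ^K suc k) * qbin q r (suc k)

module _ {c ℓ a ℓa} (K : CommutativeRing c ℓ) (R : Ring a ℓa) where
  private module K = CommutativeRing K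
  open Ring R

  record AlgebraStr : Set (c ⊔ ℓ ⊔ a ⊔ ℓa) where
    field
      ι : K.Carrier → Carrier
      ι-cong : ∀ {p q} → p K.≈ q → ι p ≈ ι q
      ι-+ : ∀ p q → ι (p K.+ q) ≈ ι p + ι q
      ι-* : ∀ p q → ι (p K.* q) ≈ ι p * ι q
      ι-1 : ι K.1# ≈ 1#
      ι-central : ∀ p r → ι p * r ≈ r * ι p

module Theory {c ℓ a ℓa} {K : CommutativeRing c ℓ} {R : Ring a ℓa}
              (alg : AlgebraStr K R) (β : CommutativeRing.Carrier K)
              (x y z : Ring.Carrier R) where
  open AlgebraStr alg
  private module K = CommutativeRing K
  open Ring R

  _·_ : K.Carrier → Carrier → Carrier
  p · r = ι p * r
  infixl 7 _·_

  _^_ : Carrier → ℕ → Carrier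
  r ^ zero = 1#
  r ^ suc n = r * (r ^ n)
  infixr 8 _^_

  Σ< : ℕ → (ℕ → Carrier) → Carrier
  Σ< zero f = 0#
  Σ< (suc n) f = Σ< n f + f n

  β^ : ℕ → K.Carrier
  β^ = _^K_ K β
  [_]β : ℕ → K.Carrier
  [ r ]β = qint K β r

  -- Polynomials in 𝕜[y] as coefficient lists (constant term first)

  Poly : Set c
  Poly = List K.Carrier

  coeff : Poly → ℕ → K.Carrier
  coeff [] j = K.0#
  coeff (p ∷ ps) zero = p
  coeff (p ∷ ps) (suc j) = coeff ps j

  _≋_ : Poly → Poly → Set ℓ
  P ≋ Q = ∀ j → coeff P j K.≈ coeff Q j
  infix 4 _≋_

  0P 1P Yp : Poly
  0P = []
  1P = K.1# ∷ []
  Yp = K.0# ∷ K.1# ∷ []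

  _+P_ : Poly → Poly → Poly
  [] +P Q = Q
  (p ∷ P) +P [] = p ∷ P
  (p ∷ P) +P (q ∷ Q) = (p K.+ q) ∷ (P +P Q)
  infixl 6 _+P_

  _·P_ : K.Carrier → Poly → Poly
  s ·P [] = []
  s ·P (p ∷ P) = (s K.* p) ∷ (s ·P P)
  infixr 7 _·P_

  Y*_ : Poly → Poly
  Y* P = K.0# ∷ P

  _*P_ : Poly → Poly → Poly
  [] *P Q = []
  (p ∷ P) *P Q = (p ·P Q) +P Y* (P *P Q)
  infixl 7 _*P_

  Ypow : ℕ → Poly
  Ypow zero = 1P
  Ypow (suc m) = Y* Ypow m

  ΣP : ℕ → (ℕ → Poly) → Poly
  ΣP zero f = 0P
  ΣP (suc n) f = ΣP n f +P f n

  ⟦_⟧ : Poly → Carrier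
  ⟦ [] ⟧ = 0#
  ⟦ p ∷ P ⟧ = ι p + y * ⟦ P ⟧

  -- index shift with the convention F (-1) = 0
  prev : (ℕ → Poly) → ℕ → Poly
  prev F zero = 0P
  prev F (suc k) = F k

  -- A is presented by generators x,y,z and relations, and the standard
  -- monomials x^i y^j z^k form a 𝕜-basis (PBW).  These properties
  -- characterise A up to isomorphism.

  mono : ℕ → ℕ → ℕ → Carrier
  mono i j k = x ^ i * y ^ j * z ^ k

  lin : ℕ → (ℕ → ℕ → ℕ → K.Carrier) → Carrier
  lin N co = Σ< N λ i → Σ< N λ j → Σ< N λ k → co i j k · mono i j k

  record IsA : Set (c ⊔ ℓ ⊔ a ⊔ ℓa) where
    field
      rel-yz : y * z - z * y ≈ 0#
      rel-zx : z * x - β · (x * z) ≈ y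
      rel-xy : x * y - y * x ≈ 0#
      pbw-independent : ∀ N (co : ℕ → ℕ → ℕ → K.Carrier) → lin N co ≈ 0# →
                        ∀ i j k → i < N → j < N → k < N → co i j k K.≈ K.0#
      pbw-spanning : ∀ r → Σ[ N ∈ ℕ ] Σ[ co ∈ (ℕ → ℕ → ℕ → K.Carrier) ] r ≈ lin N co

  Part1-explicit : Set ℓa
  Part1-explicit =
    (∀ m n → y ^ n * x ^ m ≈ x ^ m * y ^ n) ×
    (∀ m n → z ^ n * y ^ m ≈ y ^ m * z ^ n) ×
    (∀ m n → z ^ n * x ^ m ≈
       Σ< (suc (m ⊓ n)) λ k →
         (β^ ((m ∸ k) ℕ.* (n ∸ k)) K.* qbin K β n k K.* qbin K β m k K.* qfact K β k)
           · (x ^ (m ∸ k) * y ^ k * z ^ (n ∸ k)))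

  WExp : ℕ → ℕ → (ℕ → Poly) → Set ℓa
  WExp m n F = z ^ n * x ^ m ≈ Σ< (suc (m ⊓ n)) λ k → x ^ (m ∸ k) * ⟦ F k ⟧ * z ^ (n ∸ k)

  WProps : (ℕ → ℕ → ℕ → Poly) → Set (c ⊔ ℓ ⊔ ℓa)
  WProps W =
    (∀ m n → WExp m n (W m n)) ×
    (∀ m n (F : ℕ → Poly) → WExp m n F → ∀ k → k ≤ m ⊓ n → F k ≋ W m n k) ×
    (∀ m n k → m ⊓ n < k → W m n k ≋ 0P) ×
    (∀ m → W m 0 0 ≋ 1P) ×
    (∀ m k → 1 ≤ k → W m 0 k ≋ 0P) ×
    (∀ m n k → k ≤ m →
       W m (suc n) k ≋ β^ (m ∸ k) ·P W m n k +P Y* ([ m ∸ k ℕ.+ 1 ]β ·P prev (W m n) k))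

  UExp : ℕ → ℕ → ℕ → (ℕ → Poly) → Set ℓa
  UExp n m s F = (x ^ n * z ^ m) ^ s ≈
    Σ< (suc ((n ℕ.* s) ⊓ (m ℕ.* s))) λ l → x ^ (n ℕ.* s ∸ l) * ⟦ F l ⟧ * z ^ (m ℕ.* s ∸ l)

  Part2 : (ℕ → ℕ → ℕ → Poly) → Set (c ⊔ ℓ ⊔ ℓa)
  Part2 W =
    (∀ m n s → (x ^ n * y ^ m) ^ s ≈ x ^ (n ℕ.* s) * y ^ (m ℕ.* s)) ×
    (∀ m n s → (y ^ n * z ^ m) ^ s ≈ y ^ (n ℕ.* s) * z ^ (m ℕ.* s)) ×
    (Σ[ U ∈ (ℕ → ℕ → ℕ → ℕ → Poly) ]
      (∀ n m s → UExp n m s (U n m s)) ×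
      (∀ n m s (F : ℕ → Poly) → UExp n m s F →
         ∀ l → l ≤ (n ℕ.* s) ⊓ (m ℕ.* s) → F l ≋ U n m s l) ×
      (∀ n m s l → (n ℕ.* s) ⊓ (m ℕ.* s) < l → U n m s l ≋ 0P) ×
      (∀ n m → U n m 1 0 ≋ 1P) ×
      (∀ n m l → 1 ≤ l → U n m 1 l ≋ 0P) ×
      (∀ n m s l → 1 ≤ s →
         U n m (suc s) l ≋
           ΣP (suc (n ⊓ l)) λ k → U n m s (l ∸ k) *P W n (m ℕ.* s ∸ (l ∸ k)) k))

  VExp : ℕ → (ℕ → Poly) → Set ℓa
  VExp s F = (x * y * z) ^ s ≈ Σ< (suc s) λ l → x ^ (s ∸ l) * ⟦ F l ⟧ * z ^ (s ∸ l)

  Part3 : Set (c ⊔ ℓ ⊔ ℓa)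
  Part3 =
    Σ[ V ∈ (ℕ → ℕ → Poly) ]
      (∀ s → VExp s (V s)) ×
      (∀ s (F : ℕ → Poly) → VExp s F → ∀ l → l ≤ s → F l ≋ V s l) ×
      (∀ s l → s < l → V s l ≋ 0P) ×
      (V 1 0 ≋ Yp) ×
      (∀ l → 1 ≤ l → V 1 l ≋ 0P) ×
      (∀ s l → 1 ≤ s → l ≤ s →
         V (suc s) l ≋ β^ (s ∸ l) ·P (Y* V s l) +P [ s ∸ l ℕ.+ 1 ]β ·P (Y* Y* prev (V s) l)) ×
      -- the recursion at l = s+1 (where [s-l+1]_β = [0]_β = 0 and V_{s,s+1} = 0)
      (∀ s → 1 ≤ s → V (suc s) (suc s) ≋ 0P)

  RExp : ℕ → ℕ → ℕ → ℕ → (ℕ → Poly) → Set ℓa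
  RExp n m t s F = (x ^ n * y ^ m * z ^ t) ^ s ≈
    Σ< (suc ((n ℕ.* s) ⊓ (t ℕ.* s))) λ l → x ^ (n ℕ.* s ∸ l) * ⟦ F l ⟧ * z ^ (t ℕ.* s ∸ l)

  Part4 : (ℕ → ℕ → ℕ → Poly) → Set (c ⊔ ℓ ⊔ ℓa)
  Part4 W =
    Σ[ Rf ∈ (ℕ → ℕ → ℕ → ℕ → ℕ → Poly) ]
      (∀ n m t s → RExp n m t s (Rf n m t s)) ×
      (∀ n m t s (F : ℕ → Poly) → RExp n m t s F →
         ∀ l → l ≤ (n ℕ.* s) ⊓ (t ℕ.* s) → F l ≋ Rf n m t s l) ×
      (∀ n m t s l → (n ℕ.* s) ⊓ (t ℕ.* s) < l → Rf n m t s l ≋ 0P) ×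
      (∀ n m t → Rf n m t 1 0 ≋ Ypow m) ×
      (∀ n m t l → 1 ≤ l → Rf n m t 1 l ≋ 0P) ×
      (∀ n m t s l → 1 ≤ s →
         Rf n m t (suc s) l ≋
           Ypow m *P ΣP (suc (n ⊓ l)) λ k → Rf n m t s (l ∸ k) *P W n (t ℕ.* s ∸ (l ∸ k)) k)

  EExp : ℕ → (ℕ → ℕ → Poly) → Set ℓa
  EExp n F = (x + z) ^ n ≈
    Σ< (suc n) λ i → Σ< (suc (n ∸ i)) λ k → x ^ i * ⟦ F i k ⟧ * z ^ k

  Part5 : Set (c ⊔ ℓ ⊔ ℓa)
  Part5 =
    (∀ n → (x + y) ^ n ≈ Σ< (suc n) λ k → ℕ→ K (n C k) · (x ^ (n ∸ k) * y ^ k)) ×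
    (∀ n → (y + z) ^ n ≈ Σ< (suc n) λ k → ℕ→ K (n C k) · (y ^ (n ∸ k) * z ^ k)) ×
    (Σ[ E ∈ (ℕ → ℕ → ℕ → Poly) ]
      (∀ n → EExp n (E n)) ×
      (∀ n (F : ℕ → ℕ → Poly) → EExp n F → ∀ i k → i ℕ.+ k ≤ n → F i k ≋ E n i k) ×
      (∀ n i k → n < i ℕ.+ k → E n i k ≋ 0P) ×
      (E 0 0 0 ≋ 1P) ×
      (∀ n i k →
         E (suc n) i k ≋
           prev (E n i) k +P β^ k ·P prev (λ i′ → E n i′ k) i
             +P Y* ([ k ℕ.+ 1 ]β ·P E n i (suc k))))

  Claim : Set (c ⊔ ℓ ⊔ ℓa)
  Claim =
    Part1-explicit ×
    (Σ[ W ∈ (ℕ → ℕ → ℕ → Poly) ] WProps W × Part2 W × Part4 W) ×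
    Part3 ×
    Part5

{-# OPTIONS --safe #-}

-- Everything is computed in the normal form Σ x^i P(y) z^k.  Since y is central, the only
-- rewriting rules needed are z x^j = β^j x^j z + [j]_β x^(j-1) y and z^j x = β^j x z^j + [j]_β y z^(j-1).
-- Multiplying a diagonal sum Σ_l x^(a-l) F_l(y) z^(b-l) on the left by z gives the recursion for W;
-- multiplying it on the right by x^n y^m z^t and collecting terms along antidiagonals gives the
-- recursions for U, R and V (U is the case m = 0 of R); multiplying a triangular sum by x + z gives
-- the recursion for E.  The explicit formula for z^n x^m follows by induction on m from
-- z^n x^(m+1) = (z^n x) x^m and a q-Pascal identity.  Uniqueness of all coefficient polynomials
-- comes from the PBW basis: a sum Σ x^i P_ik(y) z^k vanishes only if every P_ik does.

module Submission where

open import Algebra.Bundles using (CommutativeRing; Ring)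
import Algebra.Properties.Group
import Algebra.Properties.Ring
import Algebra.Properties.Semiring.Binomial
open import Data.Empty using (⊥-elim)
open import Data.Fin using (toℕ; fromℕ; inject₁)
import Data.Fin.Properties as FinP
open import Data.List using ([]; _∷_; length)
open import Data.Nat as ℕ using (ℕ; zero; suc; _∸_; _⊓_; _⊔_; _≤_; _<_; z≤n; s≤s)
import Data.Nat.Properties as ℕP
open import Data.Nat.Solver using (module +-*-Solver)
open import Data.Sum using (_⊎_; inj₁; inj₂)
open import Function using (_∘_)
import Relation.Binary.PropositionalEquality as PE
open PE using (_≡_; _≢_)
open import Relation.Nullary using (¬_; yes; no; _×-dec_)
open import Defs

exponent-shift : ∀ n m k → suc k ≤ m → k ≤ n →
  suc n ℕ.+ (m ∸ suc k) ℕ.* (n ∸ k) ≡ (m ∸ k) ℕ.* (n ∸ k) ℕ.+ suc k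
exponent-shift n m k k<m k≤n
  rewrite PE.sym (ℕP.m∸n+n≡m k≤n) | ℕP.+-∸-assoc 1 k<m | ℕP.m+n∸n≡m (n ∸ k) k =
  solve 3 (λ d e j → con 1 :+ (d :+ j) :+ e :* d := (con 1 :+ e) :* d :+ (con 1 :+ j)) PE.refl
    (n ∸ k) (m ∸ suc k) k
  where open +-*-Solver

module QNumbers {c ℓ} (K : CommutativeRing c ℓ) (q : CommutativeRing.Carrier K) where
  open CommutativeRing K
  open import Algebra.Solver.Ring.NaturalCoefficients.Default commutativeSemiring
    using (solve; _:=_; _:+_; _:*_)
  open import Relation.Binary.Reasoning.Setoid setoid

  q^ : ℕ → Carrier
  q^ = _^K_ K q

  [_]q : ℕ → Carrier
  [_]q = qint K q

  q^-+ : ∀ a b → q^ (a ℕ.+ b) ≈ q^ a * q^ b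
  q^-+ zero b = sym (*-identityˡ _)
  q^-+ (suc a) b = trans (*-congˡ (q^-+ a b)) (sym (*-assoc _ _ _))

  qint-+ : ∀ a b → [ a ℕ.+ b ]q ≈ [ a ]q + q^ a * [ b ]q
  qint-+ a zero rewrite ℕP.+-identityʳ a = sym (trans (+-congˡ (zeroʳ _)) (+-identityʳ _))
  qint-+ a (suc b) rewrite ℕP.+-suc a b = trans (+-cong (qint-+ a b) (q^-+ a b))
    (solve 4 (λ p r s t → (p :+ r :* s) :+ r :* t := p :+ r :* (s :+ t)) refl [ a ]q (q^ a) [ b ]q (q^ b))

  qbin-beyond : ∀ {r k} → r < k → qbin K q r k ≈ 0#
  qbin-beyond {zero} {suc k} _ = refl
  qbin-beyond {suc r} {suc k} (s≤s r<k) =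
    trans (+-cong (qbin-beyond r<k) (*-congˡ (qbin-beyond (ℕP.m<n⇒m<1+n r<k))))
          (trans (+-identityˡ _) (zeroʳ _))

  qfalling : ℕ → ℕ → Carrier
  qfalling r zero = 1#
  qfalling zero (suc k) = 0#
  qfalling (suc r) (suc k) = [ suc r ]q * qfalling r k

  qfalling-beyond : ∀ {r k} → r < k → qfalling r k ≈ 0#
  qfalling-beyond {zero} {suc k} _ = refl
  qfalling-beyond {suc r} {suc k} (s≤s r<k) = trans (*-congˡ (qfalling-beyond r<k)) (zeroʳ _)

  qfalling-sucʳ : ∀ r k → qfalling r (suc k) ≈ qfalling r k * [ r ∸ k ]q
  qfalling-sucʳ zero k rewrite ℕP.0∸n≡0 k = sym (zeroʳ _)
  qfalling-sucʳ (suc r) zero = trans (*-identityʳ _) (sym (*-identityˡ _))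
  qfalling-sucʳ (suc r) (suc k) = trans (*-congˡ (qfalling-sucʳ r k)) (sym (*-assoc _ _ _))

  qbin*qfact≈qfalling : ∀ r k → qbin K q r k * qfact K q k ≈ qfalling r k
  qbin*qfact≈qfalling r zero = *-identityʳ _
  qbin*qfact≈qfalling zero (suc k) = zeroˡ _
  qbin*qfact≈qfalling (suc r) (suc k) = begin
    (qbin K q r k + q^ (suc k) * qbin K q r (suc k)) * (qfact K q k * [ suc k ]q)
      ≈⟨ solve 5 (λ a b c d e → (a :+ b :* c) :* (d :* e) := (a :* d) :* e :+ b :* (c :* (d :* e))) refl
           (qbin K q r k) (q^ (suc k)) (qbin K q r (suc k)) (qfact K q k) [ suc k ]q ⟩
    (qbin K q r k * qfact K q k) * [ suc k ]q + q^ (suc k) * (qbin K q r (suc k) * (qfact K q k * [ suc k ]q))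
      ≈⟨ +-cong (*-congʳ (qbin*qfact≈qfalling r k)) (*-congˡ (trans (qbin*qfact≈qfalling r (suc k)) (qfalling-sucʳ r k))) ⟩
    qfalling r k * [ suc k ]q + q^ (suc k) * (qfalling r k * [ r ∸ k ]q)
      ≈⟨ solve 4 (λ f a b c → f :* a :+ b :* (f :* c) := (a :+ b :* c) :* f) refl (qfalling r k) [ suc k ]q (q^ (suc k)) [ r ∸ k ]q ⟩
    ([ suc k ]q + q^ (suc k) * [ r ∸ k ]q) * qfalling r k
      ≈⟨ lastFactor (ℕP.≤-<-connex k r) ⟩
    [ suc r ]q * qfalling r k ∎
    where
    lastFactor : k ≤ r ⊎ r < k → ([ suc k ]q + q^ (suc k) * [ r ∸ k ]q) * qfalling r k ≈ [ suc r ]q * qfalling r k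
    lastFactor (inj₁ k≤r) = *-congʳ (sym (PE.subst (λ t → [ suc t ]q ≈ [ suc k ]q + q^ (suc k) * [ r ∸ k ]q) (ℕP.m+[n∸m]≡n k≤r) (qint-+ (suc k) (r ∸ k))))
    lastFactor (inj₂ r<k) = trans (*-congˡ (qfalling-beyond r<k)) (trans (zeroʳ _) (sym (trans (*-congˡ (qfalling-beyond r<k)) (zeroʳ _))))

  -- the coefficient of x^(m-k) y^k z^(n-k) in z^n x^m
  zxCoeff : ℕ → ℕ → ℕ → Carrier
  zxCoeff n m k = q^ ((m ∸ k) ℕ.* (n ∸ k)) * qbin K q n k * qbin K q m k * qfact K q k

  zxCoeff-beyond : ∀ n m k → m ⊓ n < k → zxCoeff n m k ≈ 0#
  zxCoeff-beyond n m k m⊓n<k with ℕP.≤-total m n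
  ... | inj₁ m≤n rewrite ℕP.m≤n⇒m⊓n≡m m≤n =
    trans (*-congʳ (trans (*-congˡ (qbin-beyond m⊓n<k)) (zeroʳ _))) (zeroˡ _)
  ... | inj₂ n≤m rewrite ℕP.m≥n⇒m⊓n≡n n≤m =
    trans (*-congʳ (trans (*-congʳ (trans (*-congˡ (qbin-beyond m⊓n<k)) (zeroʳ _))) (zeroˡ _))) (zeroˡ _)

  zxCoeff-recurrence : ∀ n m k →
    q^ (suc n) * zxCoeff (suc n) m (suc k) + [ suc n ]q * zxCoeff n m k ≈ zxCoeff (suc n) (suc m) (suc k)
  zxCoeff-recurrence n m k = begin
    B1 * (B2 * Qb * q1 * Qf) + S * (B0 * qn * q0 * qk)
      ≈⟨ solve 10 (λ B1 B2 B0 S Qb q1 Qf qn q0 qk →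
           B1 :* (((B2 :* Qb) :* q1) :* Qf) :+ S :* (((B0 :* qn) :* q0) :* qk)
             := ((B1 :* B2) :* q1) :* (Qb :* Qf) :+ (B0 :* q0) :* (S :* (qn :* qk))) refl
           B1 B2 B0 S Qb q1 Qf qn q0 qk ⟩
    B1 * B2 * q1 * (Qb * Qf) + B0 * q0 * (S * (qn * qk))
      ≈⟨ +-cong powers (*-congˡ (sym pascal)) ⟩
    B0 * Bk * q1 * (Qb * Qf) + B0 * q0 * (Qb * Qf)
      ≈⟨ solve 6 (λ B0 Bk Qb q1 Qf q0 →
           ((B0 :* Bk) :* q1) :* (Qb :* Qf) :+ (B0 :* q0) :* (Qb :* Qf) := ((B0 :* Qb) :* (q0 :+ Bk :* q1)) :* Qf) refl
           B0 Bk Qb q1 Qf q0 ⟩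
    B0 * Qb * (q0 + Bk * q1) * Qf ∎
    where
    B1 = q^ (suc n)
    B2 = q^ ((m ∸ suc k) ℕ.* (n ∸ k))
    B0 = q^ ((m ∸ k) ℕ.* (n ∸ k))
    Bk = q^ (suc k)
    S = [ suc n ]q
    Qb = qbin K q (suc n) (suc k)
    q1 = qbin K q m (suc k)
    Qf = qfact K q (suc k)
    qn = qbin K q n k
    q0 = qbin K q m k
    qk = qfact K q k
    pascal : Qb * Qf ≈ S * (qn * qk)
    pascal = trans (qbin*qfact≈qfalling (suc n) (suc k)) (*-congˡ (sym (qbin*qfact≈qfalling n k)))
    powers : B1 * B2 * q1 * (Qb * Qf) ≈ B0 * Bk * q1 * (Qb * Qf)
    powers with ℕP.≤-<-connex (suc k) m | ℕP.≤-<-connex k n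
    ... | inj₁ k<m | inj₁ k≤n = *-congʳ (*-congʳ (trans (sym (q^-+ (suc n) ((m ∸ suc k) ℕ.* (n ∸ k))))
            (trans (reflexive (PE.cong q^ (exponent-shift n m k k<m k≤n))) (q^-+ ((m ∸ k) ℕ.* (n ∸ k)) (suc k)))))
    ... | inj₂ m<k+1 | _ = trans (*-congʳ (trans (*-congˡ (qbin-beyond m<k+1)) (zeroʳ _)))
            (trans (zeroˡ _) (sym (trans (*-congʳ (trans (*-congˡ (qbin-beyond m<k+1)) (zeroʳ _))) (zeroˡ _))))
    ... | inj₁ _ | inj₂ n<k = trans (*-congˡ (trans (*-congʳ (qbin-beyond (s≤s n<k))) (zeroˡ _)))
            (trans (zeroʳ _) (sym (trans (*-congˡ (trans (*-congʳ (qbin-beyond (s≤s n<k))) (zeroˡ _))) (zeroʳ _))))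

  zxCoeff-at-0 : ∀ n m → zxCoeff n m 0 ≈ q^ (m ℕ.* n)
  zxCoeff-at-0 n m = trans (*-identityʳ _) (trans (*-identityʳ _) (*-identityʳ _))

  zxCoeff-suc-at-0 : ∀ n m → q^ n * zxCoeff n m 0 ≈ zxCoeff n (suc m) 0
  zxCoeff-suc-at-0 n m = trans (*-congˡ (zxCoeff-at-0 n m)) (trans (sym (q^-+ n (m ℕ.* n))) (sym (zxCoeff-at-0 n (suc m))))

module Basics {c ℓ a ℓa} {K : CommutativeRing c ℓ} {R : Ring a ℓa}
              (alg : AlgebraStr K R) (β : CommutativeRing.Carrier K) (x y z : Ring.Carrier R) where

  open Theory alg β x y z public
  open AlgebraStr alg public
  module K = CommutativeRing K
  open Ring R public hiding (zero)
  open import Relation.Binary.Reasoning.Setoid setoid public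
  open import Algebra.Properties.Group +-group using (identityˡ-unique)
  open import Algebra.Properties.CommutativeSemigroup +-commutativeSemigroup using (interchange)
  import Algebra.Properties.Semiring.Exp semiring as Exp
  open import Algebra.Properties.Monoid.Sum +-monoid using (sum; sum-init-last; sum-cong-≗; sum-cong-≋)
  open import Algebra.Properties.Semiring.Mult semiring using (_×_)
  open import Data.Nat.Combinatorics using (_C_)

  ι-0 : ι K.0# ≈ 0#
  ι-0 = identityˡ-unique (ι K.0#) (ι K.0#) (trans (sym (ι-+ K.0# K.0#)) (ι-cong (K.+-identityˡ K.0#)))

  ·-zeroˡ : ∀ r → K.0# · r ≈ 0#
  ·-zeroˡ r = trans (*-congʳ ι-0) (zeroˡ r)

  ·-identityˡ : ∀ r → K.1# · r ≈ r
  ·-identityˡ r = trans (*-congʳ ι-1) (*-identityˡ r)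

  ·-congʳ : ∀ {p q} r → p K.≈ q → p · r ≈ q · r
  ·-congʳ r p≈q = *-congʳ (ι-cong p≈q)

  ·-central : ∀ p r s → r * (p · s) ≈ p · (r * s)
  ·-central p r s = begin
    r * (ι p * s) ≈⟨ sym (*-assoc _ _ _) ⟩
    r * ι p * s   ≈⟨ *-congʳ (sym (ι-central p r)) ⟩
    ι p * r * s   ≈⟨ *-assoc _ _ _ ⟩
    ι p * (r * s) ∎

  ·-assoc : ∀ p q r → p · (q · r) ≈ (p K.* q) · r
  ·-assoc p q r = trans (sym (*-assoc _ _ _)) (*-congʳ (sym (ι-* p q)))

  ·-distribʳ : ∀ p q r → p · r + q · r ≈ (p K.+ q) · r
  ·-distribʳ p q r = trans (sym (distribʳ r (ι p) (ι q))) (*-congʳ (sym (ι-+ p q)))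

  ·-pullᵐ : ∀ p u v w → u * (p · v) * w ≈ p · (u * v * w)
  ·-pullᵐ p u v w = trans (*-congʳ (·-central p u v)) (*-assoc _ _ _)

  ·-assocᵐ : ∀ p u v w → p · u * v * w ≈ p · (u * v * w)
  ·-assocᵐ p u v w = trans (*-congʳ (*-assoc _ _ _)) (*-assoc _ _ _)

  +-≈0 : ∀ {p q} → p ≈ 0# → q ≈ 0# → p + q ≈ 0#
  +-≈0 p≈0 q≈0 = trans (+-cong p≈0 q≈0) (+-identityʳ 0#)

  *-≈0ˡ : ∀ {p} q → p ≈ 0# → p * q ≈ 0#
  *-≈0ˡ q p≈0 = trans (*-congʳ p≈0) (zeroˡ q)

  *-≈0ʳ : ∀ p {q} → q ≈ 0# → p * q ≈ 0#
  *-≈0ʳ p q≈0 = trans (*-congˡ q≈0) (zeroʳ p)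

  *-congᵐ : ∀ {l r p q} → p ≈ q → l * p * r ≈ l * q * r
  *-congᵐ p≈q = *-congʳ (*-congˡ p≈q)

  *-≈0ᵐ : ∀ {l r p} → p ≈ 0# → l * p * r ≈ 0#
  *-≈0ᵐ p≈0 = *-≈0ˡ _ (*-≈0ʳ _ p≈0)

  ≡⇒≈ : ∀ {p q} → p ≡ q → p ≈ q
  ≡⇒≈ PE.refl = refl

  Σ<-cong : ∀ n {f g : ℕ → Carrier} → (∀ i → i < n → f i ≈ g i) → Σ< n f ≈ Σ< n g
  Σ<-cong zero f≈g = refl
  Σ<-cong (suc n) f≈g = +-cong (Σ<-cong n (λ i i<n → f≈g i (ℕP.m<n⇒m<1+n i<n))) (f≈g n ℕP.≤-refl)

  Σ<-cong′ : ∀ n {f g : ℕ → Carrier} → (∀ i → f i ≈ g i) → Σ< n f ≈ Σ< n g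
  Σ<-cong′ n f≈g = Σ<-cong n (λ i _ → f≈g i)

  Σ<-zero : ∀ n {f : ℕ → Carrier} → (∀ i → i < n → f i ≈ 0#) → Σ< n f ≈ 0#
  Σ<-zero zero f≈0 = refl
  Σ<-zero (suc n) f≈0 = +-≈0 (Σ<-zero n (λ i i<n → f≈0 i (ℕP.m<n⇒m<1+n i<n))) (f≈0 n ℕP.≤-refl)

  Σ<-distrib-+ : ∀ n (f g : ℕ → Carrier) → Σ< n (λ i → f i + g i) ≈ Σ< n f + Σ< n g
  Σ<-distrib-+ zero f g = sym (+-identityʳ 0#)
  Σ<-distrib-+ (suc n) f g = trans (+-congʳ (Σ<-distrib-+ n f g)) (interchange _ _ _ _)

  *-distribˡ-Σ< : ∀ n r (f : ℕ → Carrier) → r * Σ< n f ≈ Σ< n (λ i → r * f i)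
  *-distribˡ-Σ< zero r f = zeroʳ r
  *-distribˡ-Σ< (suc n) r f = trans (distribˡ r _ _) (+-congʳ (*-distribˡ-Σ< n r f))

  *-distribʳ-Σ< : ∀ n r (f : ℕ → Carrier) → Σ< n f * r ≈ Σ< n (λ i → f i * r)
  *-distribʳ-Σ< zero r f = zeroˡ r
  *-distribʳ-Σ< (suc n) r f = trans (distribʳ r _ _) (+-congʳ (*-distribʳ-Σ< n r f))

  Σ<-head : ∀ n (f : ℕ → Carrier) → Σ< (suc n) f ≈ f 0 + Σ< n (f ∘ suc)
  Σ<-head zero f = trans (+-identityˡ _) (sym (+-identityʳ _))
  Σ<-head (suc n) f = trans (+-congʳ (Σ<-head n f)) (+-assoc _ _ _)

  Σ<-shift : ∀ n (f : ℕ → Carrier) → f 0 ≈ 0# → Σ< n (f ∘ suc) ≈ Σ< (suc n) f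
  Σ<-shift n f f0≈0 = sym (trans (Σ<-head n f) (trans (+-congʳ f0≈0) (+-identityˡ _)))

  Σ<-split : ∀ n d (f : ℕ → Carrier) → Σ< (n ℕ.+ d) f ≈ Σ< n f + Σ< d (λ i → f (n ℕ.+ i))
  Σ<-split n zero f rewrite ℕP.+-identityʳ n = sym (+-identityʳ _)
  Σ<-split n (suc d) f rewrite ℕP.+-suc n d = trans (+-congʳ (Σ<-split n d f)) (+-assoc _ _ _)

  Σ<-truncate : ∀ n m {f : ℕ → Carrier} → n ≤ m → (∀ i → n ≤ i → i < m → f i ≈ 0#) →
                Σ< m f ≈ Σ< n f
  Σ<-truncate n m {f} n≤m f≈0 = begin
    Σ< m f                                   ≡⟨ PE.cong (λ k → Σ< k f) (PE.sym (ℕP.m+[n∸m]≡n n≤m)) ⟩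
    Σ< (n ℕ.+ (m ∸ n)) f                     ≈⟨ Σ<-split n (m ∸ n) f ⟩
    Σ< n f + Σ< (m ∸ n) (λ i → f (n ℕ.+ i))  ≈⟨ +-congˡ (Σ<-zero (m ∸ n) tail≈0) ⟩
    Σ< n f + 0#                              ≈⟨ +-identityʳ _ ⟩
    Σ< n f                                   ∎
    where
    tail≈0 : ∀ i → i < m ∸ n → f (n ℕ.+ i) ≈ 0#
    tail≈0 i i<m∸n = f≈0 (n ℕ.+ i) (ℕP.m≤m+n n i)
      (PE.subst (n ℕ.+ i <_) (ℕP.m+[n∸m]≡n n≤m) (ℕP.+-monoʳ-< n i<m∸n))

  Σ<-cong-padded : ∀ n m {f g : ℕ → Carrier} →
    (∀ i → i < n → i < m → f i ≈ g i) →
    (∀ i → m ≤ i → i < n → f i ≈ 0#) →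
    (∀ i → n ≤ i → i < m → g i ≈ 0#) →
    Σ< n f ≈ Σ< m g
  Σ<-cong-padded n m f≈g f≈0 g≈0 with ℕP.≤-total n m
  ... | inj₁ n≤m = trans (Σ<-cong n (λ i i<n → f≈g i i<n (ℕP.<-≤-trans i<n n≤m))) (sym (Σ<-truncate n m n≤m g≈0))
  ... | inj₂ m≤n = trans (Σ<-truncate m n m≤n f≈0) (Σ<-cong m (λ i i<m → f≈g i (ℕP.<-≤-trans i<m m≤n) i<m))

  Σ<-support : ∀ n m B {f : ℕ → Carrier} → B < n → B < m → (∀ i → B < i → f i ≈ 0#) → Σ< n f ≈ Σ< m f
  Σ<-support n m B B<n B<m f≈0 = Σ<-cong-padded n m (λ i _ _ → refl)
    (λ i m≤i _ → f≈0 i (ℕP.<-≤-trans B<m m≤i)) (λ i n≤i _ → f≈0 i (ℕP.<-≤-trans B<n n≤i))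

  Σ<-comm : ∀ n m (f : ℕ → ℕ → Carrier) →
    Σ< n (λ i → Σ< m (f i)) ≈ Σ< m (λ j → Σ< n (λ i → f i j))
  Σ<-comm zero m f = sym (Σ<-zero m (λ _ _ → refl))
  Σ<-comm (suc n) m f = trans (+-congʳ (Σ<-comm n m f)) (sym (Σ<-distrib-+ m _ _))

  Σ<-single : ∀ n c {f : ℕ → Carrier} → c < n → (∀ i → i < n → i ≢ c → f i ≈ 0#) → Σ< n f ≈ f c
  Σ<-single (suc n) c {f} c<1+n f≈0 with n ℕ.≟ c
  ... | yes PE.refl = trans (+-congʳ (Σ<-zero n (λ i i<n → f≈0 i (ℕP.m<n⇒m<1+n i<n) (ℕP.<⇒≢ i<n))))
                            (+-identityˡ _)
  ... | no n≢c = trans (+-cong (Σ<-single n c (ℕP.≤∧≢⇒< (ℕP.≤-pred c<1+n) (n≢c ∘ PE.sym))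
                                  (λ i i<n → f≈0 i (ℕP.m<n⇒m<1+n i<n)))
                               (f≈0 n ℕP.≤-refl n≢c))
                       (+-identityʳ _)

  -- spreads f a b over the index l = a + b, so that the order of summation can be exchanged
  δ : ℕ → ℕ → Carrier → Carrier
  δ i c v with i ℕ.≟ c
  ... | yes _ = v
  ... | no _ = 0#

  δ-≡ : ∀ i c v → i ≡ c → δ i c v ≈ v
  δ-≡ i c v i≡c with i ℕ.≟ c
  ... | yes _ = refl
  ... | no i≢c = ⊥-elim (i≢c i≡c)

  δ-≢ : ∀ i c v → i ≢ c → δ i c v ≈ 0#
  δ-≢ i c v i≢c with i ℕ.≟ c
  ... | yes i≡c = ⊥-elim (i≢c i≡c)
  ... | no _ = refl

  Σ<-antidiagonals : ∀ N (f : ℕ → ℕ → Carrier) → (∀ a b → N ≤ a ⊎ N ≤ b → f a b ≈ 0#) →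
    Σ< N (λ a → Σ< N (f a)) ≈ Σ< (N ℕ.+ N) (λ l → Σ< (suc l) (λ k → f (l ∸ k) k))
  Σ<-antidiagonals N f f≈0 = begin
    Σ< N (λ a → Σ< N (f a))
      ≈⟨ Σ<-cong N (λ a a<N → Σ<-cong N (λ b b<N → sym (select a b a<N b<N))) ⟩
    Σ< N (λ a → Σ< N (λ b → Σ< M (λ l → δ l (a ℕ.+ b) (f a b))))
      ≈⟨ Σ<-cong′ N (λ a → Σ<-comm N M _) ⟩
    Σ< N (λ a → Σ< M (λ l → Σ< N (λ b → δ l (a ℕ.+ b) (f a b))))
      ≈⟨ Σ<-comm N M _ ⟩
    Σ< M (λ l → Σ< N (λ a → Σ< N (λ b → δ l (a ℕ.+ b) (f a b))))
      ≈⟨ Σ<-cong′ M (λ l → Σ<-comm N N _) ⟩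
    Σ< M (λ l → Σ< N (λ b → Σ< N (λ a → δ l (a ℕ.+ b) (f a b))))
      ≈⟨ Σ<-cong′ M (λ l → Σ<-cong-padded N (suc l) (onDiagonal l) (belowDiagonal l) (outside l)) ⟩
    Σ< M (λ l → Σ< (suc l) (λ k → f (l ∸ k) k)) ∎
    where
    M = N ℕ.+ N
    select : ∀ a b → a < N → b < N → Σ< M (λ l → δ l (a ℕ.+ b) (f a b)) ≈ f a b
    select a b a<N b<N = trans (Σ<-single M (a ℕ.+ b) (ℕP.+-mono-< a<N b<N) (λ i _ → δ-≢ i (a ℕ.+ b) (f a b)))
                               (δ-≡ (a ℕ.+ b) (a ℕ.+ b) (f a b) PE.refl)
    onDiagonal : ∀ l b → b < N → b < suc l → Σ< N (λ a → δ l (a ℕ.+ b) (f a b)) ≈ f (l ∸ b) b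
    onDiagonal l b _ b≤l with ℕP.<-≤-connex (l ∸ b) N
    ... | inj₁ l∸b<N = trans
          (Σ<-single N (l ∸ b) l∸b<N (λ i _ i≢l∸b → δ-≢ l (i ℕ.+ b) _ (λ l≡i+b → i≢l∸b (PE.sym (l∸b≡ l≡i+b)))))
          (δ-≡ l (l ∸ b ℕ.+ b) _ (PE.sym (ℕP.m∸n+n≡m (ℕP.≤-pred b≤l))))
      where
      l∸b≡ : ∀ {i} → l ≡ i ℕ.+ b → l ∸ b ≡ i
      l∸b≡ {i} l≡i+b = PE.trans (PE.cong (_∸ b) l≡i+b) (ℕP.m+n∸n≡m i b)
    ... | inj₂ N≤l∸b = trans
          (Σ<-zero N (λ i i<N → δ-≢ l (i ℕ.+ b) _ (λ l≡i+b → ℕP.<-irrefl PE.refl (ℕP.<-≤-trans i<N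
             (ℕP.≤-trans N≤l∸b (ℕP.≤-reflexive (PE.trans (PE.cong (_∸ b) l≡i+b) (ℕP.m+n∸n≡m i b))))))))
          (sym (f≈0 _ _ (inj₁ N≤l∸b)))
    belowDiagonal : ∀ l b → suc l ≤ b → b < N → Σ< N (λ a → δ l (a ℕ.+ b) (f a b)) ≈ 0#
    belowDiagonal l b l<b _ = Σ<-zero N (λ i _ → δ-≢ l (i ℕ.+ b) _ (λ l≡i+b →
      ℕP.<-irrefl PE.refl (ℕP.<-≤-trans l<b (ℕP.≤-trans (ℕP.m≤n+m b i) (ℕP.≤-reflexive (PE.sym l≡i+b))))))
    outside : ∀ l b → N ≤ b → b < suc l → f (l ∸ b) b ≈ 0#
    outside l b N≤b _ = f≈0 _ _ (inj₂ N≤b)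

  Σ<≈sum : ∀ n (f : ℕ → Carrier) → Σ< n f ≈ sum {n} (f ∘ toℕ)
  Σ<≈sum zero f = refl
  Σ<≈sum (suc n) f = begin
    Σ< n f + f n                                 ≈⟨ +-congʳ (Σ<≈sum n f) ⟩
    sum {n} (f ∘ toℕ) + f n                      ≡⟨ PE.cong₂ _+_ (sum-cong-≗ {n} (PE.cong f ∘ PE.sym ∘ FinP.toℕ-inject₁))
                                                                 (PE.cong f (PE.sym (FinP.toℕ-fromℕ n))) ⟩
    sum {n} (f ∘ toℕ ∘ inject₁) + f (toℕ (fromℕ n)) ≈⟨ sym (sum-init-last {n} (f ∘ toℕ)) ⟩
    sum {suc n} (f ∘ toℕ)                        ∎

  -- the powers of Defs unfold exactly like the library's, whose power laws are reused
  ^≡^ : ∀ r n → r ^ n ≡ r Exp.^ n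
  ^≡^ r zero = PE.refl
  ^≡^ r (suc n) = PE.cong (r *_) (^≡^ r n)

  ^-+ : ∀ r m n → r ^ (m ℕ.+ n) ≈ r ^ m * r ^ n
  ^-+ r m n rewrite ^≡^ r (m ℕ.+ n) | ^≡^ r m | ^≡^ r n = Exp.^-homo-* r m n

  ^-* : ∀ r m n → (r ^ m) ^ n ≈ r ^ (m ℕ.* n)
  ^-* r m n rewrite ^≡^ (r ^ m) n | ^≡^ r m | ^≡^ r (m ℕ.* n) = Exp.^-assocʳ r m n

  ^-congˡ : ∀ n {r s} → r ≈ s → r ^ n ≈ s ^ n
  ^-congˡ n {r} {s} r≈s rewrite ^≡^ r n | ^≡^ s n = Exp.^-congˡ n r≈s

  ^-sucʳ : ∀ r n → r ^ suc n ≈ r ^ n * r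
  ^-sucʳ r n = PE.subst (λ k → r ^ k ≈ r ^ n * r) (ℕP.+-comm n 1) (trans (^-+ r n 1) (*-congˡ (*-identityʳ r)))

  ^-commute : ∀ {p q} n → p * q ≈ q * p → p ^ n * q ≈ q * p ^ n
  ^-commute zero pq≈qp = trans (*-identityˡ _) (sym (*-identityʳ _))
  ^-commute {p} {q} (suc n) pq≈qp = begin
    p * p ^ n * q   ≈⟨ *-assoc _ _ _ ⟩
    p * (p ^ n * q) ≈⟨ *-congˡ (^-commute n pq≈qp) ⟩
    p * (q * p ^ n) ≈⟨ sym (*-assoc _ _ _) ⟩
    p * q * p ^ n   ≈⟨ *-congʳ pq≈qp ⟩
    q * p * p ^ n   ≈⟨ *-assoc _ _ _ ⟩
    q * (p * p ^ n) ∎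

  ^-commute-^ : ∀ {p q} m n → p * q ≈ q * p → p ^ m * q ^ n ≈ q ^ n * p ^ m
  ^-commute-^ m n pq≈qp = sym (^-commute n (sym (^-commute m pq≈qp)))

  ^-distrib-* : ∀ {p q} n → p * q ≈ q * p → (p * q) ^ n ≈ p ^ n * q ^ n
  ^-distrib-* zero _ = sym (*-identityˡ _)
  ^-distrib-* {p} {q} (suc n) pq≈qp = begin
    p * q * (p * q) ^ n         ≈⟨ *-congˡ (^-distrib-* n pq≈qp) ⟩
    p * q * (p ^ n * q ^ n)     ≈⟨ *-assoc _ _ _ ⟩
    p * (q * (p ^ n * q ^ n))   ≈⟨ *-congˡ (sym (*-assoc _ _ _)) ⟩
    p * (q * p ^ n * q ^ n)     ≈⟨ *-congˡ (*-congʳ (sym (^-commute n pq≈qp))) ⟩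
    p * (p ^ n * q * q ^ n)     ≈⟨ *-congˡ (*-assoc _ _ _) ⟩
    p * (p ^ n * (q * q ^ n))   ≈⟨ sym (*-assoc _ _ _) ⟩
    p * p ^ n * (q * q ^ n)     ∎

  ℕ→-· : ∀ n r → ℕ→ K n · r ≈ n × r
  ℕ→-· zero r = ·-zeroˡ r
  ℕ→-· (suc n) r = begin
    ι (K.1# K.+ ℕ→ K n) * r  ≈⟨ sym (·-distribʳ K.1# (ℕ→ K n) r) ⟩
    K.1# · r + ℕ→ K n · r    ≈⟨ +-cong (·-identityˡ r) (ℕ→-· n r) ⟩
    r + n × r                ∎

  binomial : ∀ {p q} → p * q ≈ q * p → ∀ n →
    (p + q) ^ n ≈ Σ< (suc n) (λ k → ℕ→ K (n C k) · (p ^ (n ∸ k) * q ^ k))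
  binomial {p} {q} pq≈qp n = begin
    (p + q) ^ n                                      ≈⟨ ^-congˡ n (+-comm p q) ⟩
    (q + p) ^ n                                      ≡⟨ ^≡^ (q + p) n ⟩
    (q + p) Exp.^ n                                  ≈⟨ Binomial.theorem q p (sym pq≈qp) n ⟩
    sum {suc n} (λ k → (n C toℕ k) × (q Exp.^ toℕ k * p Exp.^ (n ∸ toℕ k)))
                                                     ≈⟨ sum-cong-≋ {suc n} (λ k → term (toℕ k)) ⟩
    sum {suc n} (T ∘ toℕ)                            ≈⟨ sym (Σ<≈sum (suc n) T) ⟩
    Σ< (suc n) T                                     ∎
    where
    module Binomial = Algebra.Properties.Semiring.Binomial semiring
    T : ℕ → Carrier
    T k = ℕ→ K (n C k) · (p ^ (n ∸ k) * q ^ k)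
    term : ∀ k → (n C k) × (q Exp.^ k * p Exp.^ (n ∸ k)) ≈ T k
    term k rewrite PE.sym (^≡^ q k) | PE.sym (^≡^ p (n ∸ k)) =
      sym (trans (*-congˡ (^-commute-^ (n ∸ k) k pq≈qp)) (ℕ→-· (n C k) _))

  -- Polynomials in y

  ≋-refl : ∀ P → P ≋ P
  ≋-refl P j = K.refl

  ≋-sym : ∀ P Q → P ≋ Q → Q ≋ P
  ≋-sym P Q P≋Q j = K.sym (P≋Q j)

  ≋-trans : ∀ P Q S → P ≋ Q → Q ≋ S → P ≋ S
  ≋-trans P Q S P≋Q Q≋S j = K.trans (P≋Q j) (Q≋S j)

  coeff-+P : ∀ P Q j → coeff (P +P Q) j K.≈ coeff P j K.+ coeff Q j
  coeff-+P [] Q j = K.sym (K.+-identityˡ _)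
  coeff-+P (p ∷ P) [] j = K.sym (K.+-identityʳ _)
  coeff-+P (p ∷ P) (q ∷ Q) zero = K.refl
  coeff-+P (p ∷ P) (q ∷ Q) (suc j) = coeff-+P P Q j

  coeff-·P : ∀ s P j → coeff (s ·P P) j K.≈ s K.* coeff P j
  coeff-·P s [] j = K.sym (K.zeroʳ s)
  coeff-·P s (p ∷ P) zero = K.refl
  coeff-·P s (p ∷ P) (suc j) = coeff-·P s P j

  coeff-beyond : ∀ P {j} → length P ≤ j → coeff P j ≡ K.0#
  coeff-beyond [] _ = PE.refl
  coeff-beyond (p ∷ P) (s≤s len≤j) = coeff-beyond P len≤j

  +P-zero : ∀ P Q → P ≋ 0P → Q ≋ 0P → P +P Q ≋ 0P
  +P-zero P Q P≋0 Q≋0 j = K.trans (coeff-+P P Q j) (K.trans (K.+-cong (P≋0 j) (Q≋0 j)) (K.+-identityˡ _))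

  +P-identityˡ : ∀ P Q → P ≋ 0P → P +P Q ≋ Q
  +P-identityˡ P Q P≋0 j = K.trans (coeff-+P P Q j) (K.trans (K.+-congʳ (P≋0 j)) (K.+-identityˡ _))

  +P-identityʳ : ∀ P Q → Q ≋ 0P → P +P Q ≋ P
  +P-identityʳ P Q Q≋0 j = K.trans (coeff-+P P Q j) (K.trans (K.+-congˡ (Q≋0 j)) (K.+-identityʳ _))

  ·P-zeroˡ : ∀ s P → s K.≈ K.0# → s ·P P ≋ 0P
  ·P-zeroˡ s P s≈0 j = K.trans (coeff-·P s P j) (K.trans (K.*-congʳ s≈0) (K.zeroˡ _))

  ·P-zeroʳ : ∀ s P → P ≋ 0P → s ·P P ≋ 0P
  ·P-zeroʳ s P P≋0 j = K.trans (coeff-·P s P j) (K.trans (K.*-congˡ (P≋0 j)) (K.zeroʳ s))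

  Y*-zero : ∀ P → P ≋ 0P → Y* P ≋ 0P
  Y*-zero P P≋0 zero = K.refl
  Y*-zero P P≋0 (suc j) = P≋0 j

  *P-zeroˡ : ∀ P Q → P ≋ 0P → P *P Q ≋ 0P
  *P-zeroˡ [] Q _ = ≋-refl 0P
  *P-zeroˡ (p ∷ P) Q p∷P≋0 = +P-zero (p ·P Q) (Y* (P *P Q))
    (·P-zeroˡ p Q (p∷P≋0 zero)) (Y*-zero (P *P Q) (*P-zeroˡ P Q (p∷P≋0 ∘ suc)))

  *P-zeroʳ : ∀ P Q → Q ≋ 0P → P *P Q ≋ 0P
  *P-zeroʳ [] Q _ = ≋-refl 0P
  *P-zeroʳ (p ∷ P) Q Q≋0 = +P-zero (p ·P Q) (Y* (P *P Q))
    (·P-zeroʳ p Q Q≋0) (Y*-zero (P *P Q) (*P-zeroʳ P Q Q≋0))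

  *P-identityˡ : ∀ Q → 1P *P Q ≋ Q
  *P-identityˡ Q = ≋-trans (1P *P Q) (K.1# ·P Q) Q (+P-identityʳ (K.1# ·P Q) (Y* []) (Y*-zero [] (≋-refl [])))
                     (λ j → K.trans (coeff-·P K.1# Q j) (K.*-identityˡ _))

  *P-identityʳ : ∀ P Q → Q ≋ 1P → P *P Q ≋ P
  *P-identityʳ [] Q _ = ≋-refl []
  *P-identityʳ (p ∷ P) Q Q≋1 zero = K.trans (coeff-+P (p ·P Q) _ zero)
    (K.trans (K.+-congʳ (K.trans (coeff-·P p Q zero) (K.trans (K.*-congˡ (Q≋1 zero)) (K.*-identityʳ p))))
             (K.+-identityʳ p))
  *P-identityʳ (p ∷ P) Q Q≋1 (suc j) = K.trans (coeff-+P (p ·P Q) _ (suc j))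
    (K.trans (K.+-cong (K.trans (coeff-·P p Q (suc j)) (K.trans (K.*-congˡ (Q≋1 (suc j))) (K.zeroʳ p)))
                       (*P-identityʳ P Q Q≋1 j))
             (K.+-identityˡ _))

  ΣP-zero : ∀ n (f : ℕ → Poly) → (∀ i → i < n → f i ≋ 0P) → ΣP n f ≋ 0P
  ΣP-zero zero f _ = ≋-refl 0P
  ΣP-zero (suc n) f f≋0 = +P-zero (ΣP n f) (f n) (ΣP-zero n f (λ i i<n → f≋0 i (ℕP.m<n⇒m<1+n i<n))) (f≋0 n ℕP.≤-refl)

  ΣP-single : ∀ n c (f : ℕ → Poly) → c < n → (∀ i → i < n → i ≢ c → f i ≋ 0P) → ΣP n f ≋ f c
  ΣP-single (suc n) c f c<1+n f≋0 with n ℕ.≟ c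
  ... | yes PE.refl = +P-identityˡ (ΣP n f) (f n) (ΣP-zero n f (λ i i<n → f≋0 i (ℕP.m<n⇒m<1+n i<n) (ℕP.<⇒≢ i<n)))
  ... | no n≢c = ≋-trans (ΣP n f +P f n) (ΣP n f) (f c) (+P-identityʳ (ΣP n f) (f n) (f≋0 n ℕP.≤-refl n≢c))
                   (ΣP-single n c f (ℕP.≤∧≢⇒< (ℕP.≤-pred c<1+n) (n≢c ∘ PE.sym)) (λ i i<n → f≋0 i (ℕP.m<n⇒m<1+n i<n)))

  ⟦⟧-cong : ∀ P Q → P ≋ Q → ⟦ P ⟧ ≈ ⟦ Q ⟧
  ⟦⟧-cong [] [] _ = refl
  ⟦⟧-cong [] (q ∷ Q) []≋q∷Q =
    sym (+-≈0 (trans (ι-cong (K.sym ([]≋q∷Q zero))) ι-0) (*-≈0ʳ y (sym (⟦⟧-cong [] Q ([]≋q∷Q ∘ suc)))))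
  ⟦⟧-cong (p ∷ P) [] p∷P≋[] =
    +-≈0 (trans (ι-cong (p∷P≋[] zero)) ι-0) (*-≈0ʳ y (⟦⟧-cong P [] (p∷P≋[] ∘ suc)))
  ⟦⟧-cong (p ∷ P) (q ∷ Q) p∷P≋q∷Q = +-cong (ι-cong (p∷P≋q∷Q zero)) (*-congˡ (⟦⟧-cong P Q (p∷P≋q∷Q ∘ suc)))

  ⟦⟧-zero : ∀ P → P ≋ 0P → ⟦ P ⟧ ≈ 0#
  ⟦⟧-zero P = ⟦⟧-cong P 0P

  ⟦+P⟧ : ∀ P Q → ⟦ P +P Q ⟧ ≈ ⟦ P ⟧ + ⟦ Q ⟧
  ⟦+P⟧ [] Q = sym (+-identityˡ _)
  ⟦+P⟧ (p ∷ P) [] = sym (+-identityʳ _)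
  ⟦+P⟧ (p ∷ P) (q ∷ Q) = begin
    ι (p K.+ q) + y * ⟦ P +P Q ⟧        ≈⟨ +-cong (ι-+ p q) (*-congˡ (⟦+P⟧ P Q)) ⟩
    (ι p + ι q) + y * (⟦ P ⟧ + ⟦ Q ⟧)   ≈⟨ +-congˡ (distribˡ y _ _) ⟩
    (ι p + ι q) + (y * ⟦ P ⟧ + y * ⟦ Q ⟧) ≈⟨ interchange _ _ _ _ ⟩
    (ι p + y * ⟦ P ⟧) + (ι q + y * ⟦ Q ⟧) ∎

  ⟦·P⟧ : ∀ s P → ⟦ s ·P P ⟧ ≈ s · ⟦ P ⟧
  ⟦·P⟧ s [] = sym (zeroʳ _)
  ⟦·P⟧ s (p ∷ P) = begin
    ι (s K.* p) + y * ⟦ s ·P P ⟧  ≈⟨ +-cong (ι-* s p) (trans (*-congˡ (⟦·P⟧ s P)) (·-central s y _)) ⟩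
    ι s * ι p + ι s * (y * ⟦ P ⟧) ≈⟨ sym (distribˡ _ _ _) ⟩
    ι s * (ι p + y * ⟦ P ⟧)       ∎

  ⟦Y*⟧ : ∀ P → ⟦ Y* P ⟧ ≈ y * ⟦ P ⟧
  ⟦Y*⟧ P = trans (+-congʳ ι-0) (+-identityˡ _)

  ⟦*P⟧ : ∀ P Q → ⟦ P *P Q ⟧ ≈ ⟦ P ⟧ * ⟦ Q ⟧
  ⟦*P⟧ [] Q = sym (zeroˡ _)
  ⟦*P⟧ (p ∷ P) Q = begin
    ⟦ p ·P Q +P Y* (P *P Q) ⟧       ≈⟨ ⟦+P⟧ (p ·P Q) _ ⟩
    ⟦ p ·P Q ⟧ + ⟦ Y* (P *P Q) ⟧    ≈⟨ +-cong (⟦·P⟧ p Q) (trans (⟦Y*⟧ (P *P Q)) (*-congˡ (⟦*P⟧ P Q))) ⟩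
    ι p * ⟦ Q ⟧ + y * (⟦ P ⟧ * ⟦ Q ⟧) ≈⟨ +-congˡ (sym (*-assoc _ _ _)) ⟩
    ι p * ⟦ Q ⟧ + y * ⟦ P ⟧ * ⟦ Q ⟧   ≈⟨ sym (distribʳ _ _ _) ⟩
    (ι p + y * ⟦ P ⟧) * ⟦ Q ⟧         ∎

  ⟦ΣP⟧ : ∀ n f → ⟦ ΣP n f ⟧ ≈ Σ< n (λ i → ⟦ f i ⟧)
  ⟦ΣP⟧ zero f = refl
  ⟦ΣP⟧ (suc n) f = trans (⟦+P⟧ (ΣP n f) (f n)) (+-congʳ (⟦ΣP⟧ n f))

  ⟦1P⟧ : ⟦ 1P ⟧ ≈ 1#
  ⟦1P⟧ = trans (+-cong ι-1 (zeroʳ y)) (+-identityʳ _)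

  ⟦Ypow⟧ : ∀ m → ⟦ Ypow m ⟧ ≈ y ^ m
  ⟦Ypow⟧ zero = ⟦1P⟧
  ⟦Ypow⟧ (suc m) = trans (⟦Y*⟧ (Ypow m)) (*-congˡ (⟦Ypow⟧ m))

  ⟦⟧-as-Σ< : ∀ P M → length P ≤ M → ⟦ P ⟧ ≈ Σ< M (λ j → coeff P j · y ^ j)
  ⟦⟧-as-Σ< [] M _ = sym (Σ<-zero M (λ j _ → ·-zeroˡ _))
  ⟦⟧-as-Σ< (p ∷ P) (suc M) (s≤s len≤M) = begin
    ι p + y * ⟦ P ⟧                                        ≈⟨ +-cong (sym (*-identityʳ _)) (*-congˡ (⟦⟧-as-Σ< P M len≤M)) ⟩
    p · 1# + y * Σ< M (λ j → coeff P j · y ^ j)            ≈⟨ +-congˡ (*-distribˡ-Σ< M y _) ⟩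
    p · 1# + Σ< M (λ j → y * (coeff P j · y ^ j))          ≈⟨ +-congˡ (Σ<-cong′ M (λ j → ·-central _ _ _)) ⟩
    p · 1# + Σ< M (λ j → coeff P j · y ^ suc j)            ≈⟨ sym (Σ<-head M _) ⟩
    Σ< (suc M) (λ j → coeff (p ∷ P) j · y ^ j)             ∎

  ⟦⟧-commute : ∀ r → y * r ≈ r * y → ∀ P → ⟦ P ⟧ * r ≈ r * ⟦ P ⟧
  ⟦⟧-commute r _ [] = trans (zeroˡ r) (sym (zeroʳ r))
  ⟦⟧-commute r yr≈ry (p ∷ P) = begin
    (ι p + y * ⟦ P ⟧) * r     ≈⟨ distribʳ _ _ _ ⟩
    ι p * r + y * ⟦ P ⟧ * r   ≈⟨ +-cong (ι-central p r) (*-assoc _ _ _) ⟩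
    r * ι p + y * (⟦ P ⟧ * r) ≈⟨ +-congˡ (*-congˡ (⟦⟧-commute r yr≈ry P)) ⟩
    r * ι p + y * (r * ⟦ P ⟧) ≈⟨ +-congˡ (sym (*-assoc _ _ _)) ⟩
    r * ι p + y * r * ⟦ P ⟧   ≈⟨ +-congˡ (*-congʳ yr≈ry) ⟩
    r * ι p + r * y * ⟦ P ⟧   ≈⟨ +-congˡ (*-assoc _ _ _) ⟩
    r * ι p + r * (y * ⟦ P ⟧) ≈⟨ sym (distribˡ _ _ _) ⟩
    r * (ι p + y * ⟦ P ⟧)     ∎

  xPz : ℕ → Poly → ℕ → Carrier
  xPz i P k = x ^ i * ⟦ P ⟧ * z ^ k

  diag : ℕ → ℕ → (ℕ → Poly) → Carrier
  diag a b F = Σ< (suc (a ⊓ b)) λ l → xPz (a ∸ l) (F l) (b ∸ l)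

  square : ℕ → (ℕ → ℕ → Poly) → Carrier
  square N F = Σ< N λ i → Σ< N λ k → xPz i (F i k) k

  tri : ℕ → (ℕ → ℕ → Poly) → Carrier
  tri n F = Σ< (suc n) λ i → Σ< (suc (n ∸ i)) λ k → xPz i (F i k) k

  VanishesAbove : ℕ → (ℕ → Poly) → Set ℓ
  VanishesAbove L F = ∀ l → L < l → F l ≋ 0P

  VanishesOutside : ℕ → (ℕ → ℕ → Poly) → Set ℓ
  VanishesOutside N F = ∀ i k → N ≤ i ⊎ N ≤ k → F i k ≋ 0P

  xPz-cong : ∀ i k P Q → P ≋ Q → xPz i P k ≈ xPz i Q k
  xPz-cong i k P Q P≋Q = *-congᵐ (⟦⟧-cong P Q P≋Q)

  xPz-zero : ∀ i k P → P ≋ 0P → xPz i P k ≈ 0#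
  xPz-zero i k P P≋0 = *-≈0ᵐ (⟦⟧-zero P P≋0)

  xPz-+P : ∀ i k P Q → xPz i (P +P Q) k ≈ xPz i P k + xPz i Q k
  xPz-+P i k P Q = trans (*-congᵐ (⟦+P⟧ P Q)) (trans (*-congʳ (distribˡ _ _ _)) (distribʳ _ _ _))

  xPz-·P : ∀ i k s P → xPz i (s ·P P) k ≈ s · xPz i P k
  xPz-·P i k s P = trans (*-congᵐ (⟦·P⟧ s P)) (·-pullᵐ s _ _ _)

  *-distribᵐ-Σ< : ∀ l r n (g : ℕ → Carrier) → l * Σ< n g * r ≈ Σ< n (λ i → l * g i * r)
  *-distribᵐ-Σ< l r n g = trans (*-congʳ (*-distribˡ-Σ< n l g)) (*-distribʳ-Σ< n r _)

module NormalForms {c ℓ a ℓa} {K : CommutativeRing c ℓ} {R : Ring a ℓa}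
              (alg : AlgebraStr K R) (β : CommutativeRing.Carrier K) (x y z : Ring.Carrier R)
              (isA : Theory.IsA alg β x y z) where

  open Basics alg β x y z public
  open IsA isA public
  open import Data.Product using (_×_; _,_; proj₁; proj₂)
  open import Algebra.Properties.Group +-group using (x∙y⁻¹≈ε⇒x≈y)

  yz≈zy : y * z ≈ z * y
  yz≈zy = x∙y⁻¹≈ε⇒x≈y _ _ rel-yz

  xy≈yx : x * y ≈ y * x
  xy≈yx = x∙y⁻¹≈ε⇒x≈y _ _ rel-xy

  zx≈βxz+y : z * x ≈ β · (x * z) + y
  zx≈βxz+y = begin
    z * x                                  ≈⟨ sym (+-identityʳ _) ⟩
    z * x + 0#                             ≈⟨ +-congˡ (sym (-‿inverseˡ _)) ⟩
    z * x + (- (β · (x * z)) + β · (x * z)) ≈⟨ sym (+-assoc _ _ _) ⟩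
    (z * x - β · (x * z)) + β · (x * z)    ≈⟨ +-congʳ rel-zx ⟩
    y + β · (x * z)                        ≈⟨ +-comm _ _ ⟩
    β · (x * z) + y                        ∎

  ⟦⟧x≈x⟦⟧ : ∀ P → ⟦ P ⟧ * x ≈ x * ⟦ P ⟧
  ⟦⟧x≈x⟦⟧ = ⟦⟧-commute x (sym xy≈yx)

  ⟦⟧y≈y⟦⟧ : ∀ P → ⟦ P ⟧ * y ≈ y * ⟦ P ⟧
  ⟦⟧y≈y⟦⟧ = ⟦⟧-commute y refl

  ⟦⟧z≈z⟦⟧ : ∀ P → ⟦ P ⟧ * z ≈ z * ⟦ P ⟧
  ⟦⟧z≈z⟦⟧ = ⟦⟧-commute z yz≈zy

  zx^ : ∀ j → z * x ^ j ≈ β^ j · (x ^ j * z) + [ j ]β · (x ^ (j ∸ 1) * y)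
  zx^ zero = begin
    z * 1#                                ≈⟨ *-identityʳ z ⟩
    z                                     ≈⟨ sym (trans (·-identityˡ _) (*-identityˡ z)) ⟩
    K.1# · (1# * z)                       ≈⟨ sym (+-identityʳ _) ⟩
    K.1# · (1# * z) + 0#                  ≈⟨ +-congˡ (sym (·-zeroˡ _)) ⟩
    K.1# · (1# * z) + K.0# · (1# * y)     ∎
  zx^ (suc j) = begin
    z * x ^ suc j                                                  ≈⟨ *-congˡ (^-sucʳ x j) ⟩
    z * (x ^ j * x)                                                ≈⟨ sym (*-assoc _ _ _) ⟩
    z * x ^ j * x                                                  ≈⟨ *-congʳ (zx^ j) ⟩
    (β^ j · (x ^ j * z) + [ j ]β · (x ^ (j ∸ 1) * y)) * x          ≈⟨ distribʳ _ _ _ ⟩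
    β^ j · (x ^ j * z) * x + [ j ]β · (x ^ (j ∸ 1) * y) * x        ≈⟨ +-cong moveZ (moveY j) ⟩
    (β^ (suc j) · (x ^ suc j * z) + β^ j · (x ^ j * y)) + [ j ]β · (x ^ j * y)
                                                                   ≈⟨ +-assoc _ _ _ ⟩
    β^ (suc j) · (x ^ suc j * z) + (β^ j · (x ^ j * y) + [ j ]β · (x ^ j * y))
                                                                   ≈⟨ +-congˡ (trans (+-comm _ _) (·-distribʳ _ _ _)) ⟩
    β^ (suc j) · (x ^ suc j * z) + [ suc j ]β · (x ^ j * y)        ∎
    where
    x^x≈x^suc : ∀ r → x ^ j * (x * r) ≈ x ^ suc j * r
    x^x≈x^suc r = trans (sym (*-assoc _ _ _)) (*-congʳ (sym (^-sucʳ x j)))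
    moveZ : β^ j · (x ^ j * z) * x ≈ β^ (suc j) · (x ^ suc j * z) + β^ j · (x ^ j * y)
    moveZ = begin
      ι (β^ j) * (x ^ j * z) * x                            ≈⟨ *-assoc _ _ _ ⟩
      β^ j · (x ^ j * z * x)                                ≈⟨ *-congˡ (*-assoc _ _ _) ⟩
      β^ j · (x ^ j * (z * x))                              ≈⟨ *-congˡ (*-congˡ zx≈βxz+y) ⟩
      β^ j · (x ^ j * (β · (x * z) + y))                    ≈⟨ *-congˡ (distribˡ _ _ _) ⟩
      β^ j · (x ^ j * (β · (x * z)) + x ^ j * y)            ≈⟨ *-congˡ (+-congʳ (trans (·-central β _ _) (*-congˡ (x^x≈x^suc z)))) ⟩
      β^ j · (β · (x ^ suc j * z) + x ^ j * y)              ≈⟨ distribˡ _ _ _ ⟩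
      β^ j · (β · (x ^ suc j * z)) + β^ j · (x ^ j * y)     ≈⟨ +-congʳ (trans (·-assoc _ _ _) (·-congʳ _ (K.*-comm _ _))) ⟩
      β^ (suc j) · (x ^ suc j * z) + β^ j · (x ^ j * y)     ∎
    moveY : ∀ j → [ j ]β · (x ^ (j ∸ 1) * y) * x ≈ [ j ]β · (x ^ j * y)
    moveY zero = trans (*-≈0ˡ x (·-zeroˡ _)) (sym (·-zeroˡ _))
    moveY (suc i) = begin
      [ suc i ]β · (x ^ i * y) * x     ≈⟨ *-assoc _ _ _ ⟩
      [ suc i ]β · (x ^ i * y * x)     ≈⟨ *-congˡ (trans (*-assoc _ _ _) (*-congˡ (sym xy≈yx))) ⟩
      [ suc i ]β · (x ^ i * (x * y))   ≈⟨ *-congˡ (trans (sym (*-assoc _ _ _)) (*-congʳ (sym (^-sucʳ x i)))) ⟩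
      [ suc i ]β · (x ^ suc i * y)     ∎

  z^x : ∀ j → z ^ j * x ≈ β^ j · (x * z ^ j) + [ j ]β · (y * z ^ (j ∸ 1))
  z^x zero = begin
    1# * x                                ≈⟨ *-identityˡ x ⟩
    x                                     ≈⟨ sym (trans (·-identityˡ _) (*-identityʳ x)) ⟩
    K.1# · (x * 1#)                       ≈⟨ sym (+-identityʳ _) ⟩
    K.1# · (x * 1#) + 0#                  ≈⟨ +-congˡ (sym (·-zeroˡ _)) ⟩
    K.1# · (x * 1#) + K.0# · (y * 1#)     ∎
  z^x (suc j) = begin
    z * z ^ j * x                                                  ≈⟨ *-assoc _ _ _ ⟩
    z * (z ^ j * x)                                                ≈⟨ *-congˡ (z^x j) ⟩
    z * (β^ j · (x * z ^ j) + [ j ]β · (y * z ^ (j ∸ 1)))          ≈⟨ distribˡ _ _ _ ⟩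
    z * (β^ j · (x * z ^ j)) + z * ([ j ]β · (y * z ^ (j ∸ 1)))    ≈⟨ +-cong moveX (moveY j) ⟩
    (β^ (suc j) · (x * z ^ suc j) + β^ j · (y * z ^ j)) + [ j ]β · (y * z ^ j)
                                                                   ≈⟨ +-assoc _ _ _ ⟩
    β^ (suc j) · (x * z ^ suc j) + (β^ j · (y * z ^ j) + [ j ]β · (y * z ^ j))
                                                                   ≈⟨ +-congˡ (trans (+-comm _ _) (·-distribʳ _ _ _)) ⟩
    β^ (suc j) · (x * z ^ suc j) + [ suc j ]β · (y * z ^ j)        ∎
    where
    moveX : z * (β^ j · (x * z ^ j)) ≈ β^ (suc j) · (x * z ^ suc j) + β^ j · (y * z ^ j)
    moveX = begin
      z * (β^ j · (x * z ^ j))                              ≈⟨ ·-central _ _ _ ⟩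
      β^ j · (z * (x * z ^ j))                              ≈⟨ *-congˡ (sym (*-assoc _ _ _)) ⟩
      β^ j · (z * x * z ^ j)                                ≈⟨ *-congˡ (*-congʳ zx≈βxz+y) ⟩
      β^ j · ((β · (x * z) + y) * z ^ j)                    ≈⟨ *-congˡ (distribʳ _ _ _) ⟩
      β^ j · (β · (x * z) * z ^ j + y * z ^ j)              ≈⟨ *-congˡ (+-congʳ (trans (*-assoc _ _ _) (*-congˡ (*-assoc _ _ _)))) ⟩
      β^ j · (β · (x * z ^ suc j) + y * z ^ j)              ≈⟨ distribˡ _ _ _ ⟩
      β^ j · (β · (x * z ^ suc j)) + β^ j · (y * z ^ j)     ≈⟨ +-congʳ (trans (·-assoc _ _ _) (·-congʳ _ (K.*-comm _ _))) ⟩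
      β^ (suc j) · (x * z ^ suc j) + β^ j · (y * z ^ j)     ∎
    moveY : ∀ j → z * ([ j ]β · (y * z ^ (j ∸ 1))) ≈ [ j ]β · (y * z ^ j)
    moveY zero = trans (*-≈0ʳ z (·-zeroˡ _)) (sym (·-zeroˡ _))
    moveY (suc i) = begin
      z * ([ suc i ]β · (y * z ^ i))   ≈⟨ ·-central _ _ _ ⟩
      [ suc i ]β · (z * (y * z ^ i))   ≈⟨ *-congˡ (trans (sym (*-assoc _ _ _)) (*-congʳ (sym yz≈zy))) ⟩
      [ suc i ]β · (y * z * z ^ i)     ≈⟨ *-congˡ (*-assoc _ _ _) ⟩
      [ suc i ]β · (y * z ^ suc i)     ∎

  -- Uniqueness of coefficients, from the PBW basis

  maxUpTo : ℕ → (ℕ → ℕ) → ℕ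
  maxUpTo zero f = 0
  maxUpTo (suc n) f = maxUpTo n f ⊔ f n

  maxUpTo-≥ : ∀ n f {i} → i < n → f i ≤ maxUpTo n f
  maxUpTo-≥ (suc n) f {i} i<1+n with ℕP.m≤n⇒m<n∨m≡n (ℕP.≤-pred i<1+n)
  ... | inj₁ i<n = ℕP.≤-trans (maxUpTo-≥ n f i<n) (ℕP.m≤m⊔n _ _)
  ... | inj₂ PE.refl = ℕP.m≤n⊔m _ _

  module _ (N : ℕ) (D : ℕ → ℕ → Poly) (D≋0 : VanishesOutside N D) where
    private
      -- M bounds i, k and every y-degree, so lin M co is the square sum written in the PBW basis
      L = maxUpTo N (λ i → maxUpTo N (λ k → length (D i k)))
      M = N ℕ.+ L

      co : ℕ → ℕ → ℕ → K.Carrier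
      co i j k = coeff (D i k) j

      N≤M : ∀ {i} → i < N → i < M
      N≤M i<N = ℕP.<-≤-trans i<N (ℕP.m≤m+n N L)

      length≤M : ∀ {i k} → i < N → k < N → length (D i k) ≤ M
      length≤M {i} i<N k<N = ℕP.≤-trans
        (ℕP.≤-trans (maxUpTo-≥ N _ k<N) (maxUpTo-≥ N (λ i → maxUpTo N (λ k → length (D i k))) i<N))
        (ℕP.m≤n+m L N)

      column-zero : ∀ i k → N ≤ i ⊎ N ≤ k → Σ< M (λ j → co i j k · mono i j k) ≈ 0#
      column-zero i k outside = Σ<-zero M (λ j _ → *-≈0ˡ _ (trans (ι-cong (D≋0 i k outside j)) ι-0))

      column : ∀ i k → Σ< M (λ j → co i j k · mono i j k) ≈ xPz i (D i k) k
      column i k with ℕP.<-≤-connex i N | ℕP.<-≤-connex k N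
      ... | inj₁ i<N | inj₁ k<N = begin
        Σ< M (λ j → co i j k · (x ^ i * y ^ j * z ^ k))
          ≈⟨ Σ<-cong′ M (λ j → trans (sym (*-assoc _ _ _)) (*-congʳ (sym (·-central _ _ _)))) ⟩
        Σ< M (λ j → x ^ i * (co i j k · y ^ j) * z ^ k)  ≈⟨ sym (*-distribᵐ-Σ< _ _ M _) ⟩
        x ^ i * Σ< M (λ j → co i j k · y ^ j) * z ^ k    ≈⟨ *-congᵐ (sym (⟦⟧-as-Σ< (D i k) M (length≤M i<N k<N))) ⟩
        xPz i (D i k) k                                  ∎
      ... | inj₂ N≤i | _ = trans (column-zero i k (inj₁ N≤i)) (sym (xPz-zero i k (D i k) (D≋0 i k (inj₁ N≤i))))
      ... | inj₁ _ | inj₂ N≤k = trans (column-zero i k (inj₂ N≤k)) (sym (xPz-zero i k (D i k) (D≋0 i k (inj₂ N≤k))))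

      lin≈square : lin M co ≈ square N D
      lin≈square = begin
        Σ< M (λ i → Σ< M (λ j → Σ< M (λ k → co i j k · mono i j k)))  ≈⟨ Σ<-cong′ M (λ i → Σ<-comm M M _) ⟩
        Σ< M (λ i → Σ< M (λ k → Σ< M (λ j → co i j k · mono i j k)))  ≈⟨ Σ<-cong′ M (λ i → Σ<-cong′ M (column i)) ⟩
        Σ< M (λ i → Σ< M (λ k → xPz i (D i k) k))
          ≈⟨ Σ<-truncate N M (ℕP.m≤m+n N L) (λ i N≤i _ → Σ<-zero M (λ k _ → xPz-zero i k (D i k) (D≋0 i k (inj₁ N≤i)))) ⟩
        Σ< N (λ i → Σ< M (λ k → xPz i (D i k) k))
          ≈⟨ Σ<-cong′ N (λ i → Σ<-truncate N M (ℕP.m≤m+n N L) (λ k N≤k _ → xPz-zero i k (D i k) (D≋0 i k (inj₂ N≤k)))) ⟩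
        Σ< N (λ i → Σ< N (λ k → xPz i (D i k) k))                     ∎

    square-zero : square N D ≈ 0# → ∀ i k → i < N → k < N → D i k ≋ 0P
    square-zero square≈0 i k i<N k<N j with j ℕ.<? M
    ... | yes j<M = pbw-independent M co (trans lin≈square square≈0) i j k (N≤M i<N) j<M (N≤M k<N)
    ... | no j≮M = K.reflexive (coeff-beyond (D i k) (ℕP.≤-trans (length≤M i<N k<N) (ℕP.≮⇒≥ j≮M)))

  module _ (a b : ℕ) (H : ℕ → Poly) where
    private
      N = suc (a ℕ.+ b)

      a∸l<N : ∀ l → a ∸ l < N
      a∸l<N l = s≤s (ℕP.≤-trans (ℕP.m∸n≤m a l) (ℕP.m≤m+n a b))

      b∸l<N : ∀ l → b ∸ l < N
      b∸l<N l = s≤s (ℕP.≤-trans (ℕP.m∸n≤m b l) (ℕP.m≤n+m b a))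

      -- the diagonal sum as a square sum: H l sits at position (a - l, b - l)
      point : ℕ → ℕ → ℕ → Poly
      point i k l with (i ℕ.≟ a ∸ l) ×-dec (k ℕ.≟ b ∸ l)
      ... | yes _ = H l
      ... | no _ = 0P

      point-on : ∀ l → point (a ∸ l) (b ∸ l) l ≡ H l
      point-on l with (a ∸ l ℕ.≟ a ∸ l) ×-dec (b ∸ l ℕ.≟ b ∸ l)
      ... | yes _ = PE.refl
      ... | no off = ⊥-elim (off (PE.refl , PE.refl))

      point-off : ∀ i k l → ¬ (i ≡ a ∸ l × k ≡ b ∸ l) → point i k l ≡ 0P
      point-off i k l off with (i ℕ.≟ a ∸ l) ×-dec (k ℕ.≟ b ∸ l)
      ... | yes on = ⊥-elim (off on)
      ... | no _ = PE.refl

      xPz-point-off : ∀ i k l → ¬ (i ≡ a ∸ l × k ≡ b ∸ l) → xPz i (point i k l) k ≈ 0#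
      xPz-point-off i k l off rewrite point-off i k l off = *-≈0ᵐ refl

      D : ℕ → ℕ → Poly
      D i k = ΣP (suc (a ⊓ b)) (point i k)

      D-outside : VanishesOutside N D
      D-outside i k outside = ΣP-zero (suc (a ⊓ b)) (point i k) (λ l _ → PE.subst (_≋ 0P) (PE.sym (point-off i k l (off {l} outside))) (≋-refl 0P))
        where
        off : ∀ {l} → N ≤ i ⊎ N ≤ k → ¬ (i ≡ a ∸ l × k ≡ b ∸ l)
        off {l} (inj₁ N≤i) (PE.refl , _) = ℕP.<⇒≱ (a∸l<N l) N≤i
        off {l} (inj₂ N≤k) (_ , PE.refl) = ℕP.<⇒≱ (b∸l<N l) N≤k

      D-on : ∀ l → l ≤ a ⊓ b → D (a ∸ l) (b ∸ l) ≋ H l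
      D-on l l≤L = PE.subst (D (a ∸ l) (b ∸ l) ≋_) (point-on l)
        (ΣP-single (suc (a ⊓ b)) l (point (a ∸ l) (b ∸ l)) (s≤s l≤L)
          (λ l′ l′<1+L l′≢l → PE.subst (_≋ 0P) (PE.sym (point-off (a ∸ l) (b ∸ l) l′ (λ (a∸l≡a∸l′ , _) →
             l′≢l (PE.sym (ℕP.∸-cancelˡ-≡ (≤a l≤L) (≤a (ℕP.≤-pred l′<1+L)) a∸l≡a∸l′))))) (≋-refl 0P)))
        where
        ≤a : ∀ {l} → l ≤ a ⊓ b → l ≤ a
        ≤a l≤L = ℕP.≤-trans l≤L (ℕP.m⊓n≤m a b)

      square≈diag : square N D ≈ diag a b H
      square≈diag = begin
        Σ< N (λ i → Σ< N (λ k → xPz i (D i k) k))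
          ≈⟨ Σ<-cong′ N (λ i → Σ<-cong′ N (λ k → trans (*-congᵐ (⟦ΣP⟧ (suc (a ⊓ b)) (point i k))) (*-distribᵐ-Σ< (x ^ i) (z ^ k) (suc (a ⊓ b)) _))) ⟩
        Σ< N (λ i → Σ< N (λ k → Σ< (suc (a ⊓ b)) (λ l → xPz i (point i k l) k)))
          ≈⟨ Σ<-cong′ N (λ i → Σ<-comm N (suc (a ⊓ b)) _) ⟩
        Σ< N (λ i → Σ< (suc (a ⊓ b)) (λ l → Σ< N (λ k → xPz i (point i k l) k)))
          ≈⟨ Σ<-comm N (suc (a ⊓ b)) _ ⟩
        Σ< (suc (a ⊓ b)) (λ l → Σ< N (λ i → Σ< N (λ k → xPz i (point i k l) k)))
          ≈⟨ Σ<-cong′ (suc (a ⊓ b)) pick ⟩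
        diag a b H ∎
        where
        pick : ∀ l → Σ< N (λ i → Σ< N (λ k → xPz i (point i k l) k)) ≈ xPz (a ∸ l) (H l) (b ∸ l)
        pick l = begin
          Σ< N (λ i → Σ< N (λ k → xPz i (point i k l) k))
            ≈⟨ Σ<-single N (a ∸ l) (a∸l<N l) (λ i _ i≢ → Σ<-zero N (λ k _ → xPz-point-off i k l (i≢ ∘ proj₁))) ⟩
          Σ< N (λ k → xPz (a ∸ l) (point (a ∸ l) k l) k)
            ≈⟨ Σ<-single N (b ∸ l) (b∸l<N l) (λ k _ k≢ → xPz-point-off (a ∸ l) k l (k≢ ∘ proj₂)) ⟩
          xPz (a ∸ l) (point (a ∸ l) (b ∸ l) l) (b ∸ l)
            ≡⟨ PE.cong (λ P → xPz (a ∸ l) P (b ∸ l)) (point-on l) ⟩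
          xPz (a ∸ l) (H l) (b ∸ l) ∎

    diag-zero : diag a b H ≈ 0# → ∀ l → l ≤ a ⊓ b → H l ≋ 0P
    diag-zero diag≈0 l l≤L = ≋-trans (H l) (D (a ∸ l) (b ∸ l)) 0P (≋-sym (D (a ∸ l) (b ∸ l)) (H l) (D-on l l≤L))
      (square-zero N D D-outside (trans square≈diag diag≈0) (a ∸ l) (b ∸ l) (a∸l<N l) (b∸l<N l))

  module _ (n : ℕ) (H : ℕ → ℕ → Poly) where
    private
      D : ℕ → ℕ → Poly
      D i k with i ℕ.+ k ℕ.≤? n
      ... | yes _ = H i k
      ... | no _ = 0P

      D-on : ∀ i k → i ℕ.+ k ≤ n → D i k ≡ H i k
      D-on i k i+k≤n with i ℕ.+ k ℕ.≤? n
      ... | yes _ = PE.refl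
      ... | no i+k≰n = ⊥-elim (i+k≰n i+k≤n)

      D-off : ∀ i k → n < i ℕ.+ k → D i k ≡ 0P
      D-off i k n<i+k with i ℕ.+ k ℕ.≤? n
      ... | yes i+k≤n = ⊥-elim (ℕP.<⇒≱ n<i+k i+k≤n)
      ... | no _ = PE.refl

      D-outside : VanishesOutside (suc n) D
      D-outside i k outside = PE.subst (_≋ 0P) (PE.sym (D-off i k (n<i+k outside))) (≋-refl 0P)
        where
        n<i+k : suc n ≤ i ⊎ suc n ≤ k → n < i ℕ.+ k
        n<i+k (inj₁ n<i) = ℕP.<-≤-trans n<i (ℕP.m≤m+n i k)
        n<i+k (inj₂ n<k) = ℕP.<-≤-trans n<k (ℕP.m≤n+m k i)

      square≈tri : square (suc n) D ≈ tri n H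
      square≈tri = Σ<-cong (suc n) (λ i i<1+n → Σ<-cong-padded (suc n) (suc (n ∸ i))
        (λ k _ k≤n∸i → ≡⇒≈ (PE.cong (λ P → xPz i P k) (D-on i k (i+k≤n (ℕP.≤-pred i<1+n) (ℕP.≤-pred k≤n∸i)))))
        (λ k n∸i<k _ → xPz-zero i k (D i k) (PE.subst (_≋ 0P) (PE.sym (D-off i k (n<i+k n∸i<k))) (≋-refl 0P)))
        (λ k 1+n≤k k≤n∸i → ⊥-elim (ℕP.<⇒≱ (ℕP.≤-<-trans (ℕP.≤-pred k≤n∸i) (s≤s (ℕP.m∸n≤m n i))) 1+n≤k)))
        where
        i+k≤n : ∀ {i k} → i ≤ n → k ≤ n ∸ i → i ℕ.+ k ≤ n
        i+k≤n {i} i≤n k≤n∸i = PE.subst (i ℕ.+ _ ≤_) (ℕP.m+[n∸m]≡n i≤n) (ℕP.+-monoʳ-≤ i k≤n∸i)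
        n<i+k : ∀ {i k} → n ∸ i < k → n < i ℕ.+ k
        n<i+k {i} {k} n∸i<k = ℕP.≤-<-trans (ℕP.m≤n+m∸n n i) (ℕP.+-monoʳ-< i n∸i<k)

    tri-zero : tri n H ≈ 0# → ∀ i k → i ℕ.+ k ≤ n → H i k ≋ 0P
    tri-zero tri≈0 i k i+k≤n = PE.subst (_≋ 0P) (D-on i k i+k≤n)
      (square-zero (suc n) D D-outside (trans square≈tri tri≈0) i k
        (s≤s (ℕP.≤-trans (ℕP.m≤m+n i k) i+k≤n)) (s≤s (ℕP.≤-trans (ℕP.m≤n+m k i) i+k≤n)))

  _−P_ : Poly → Poly → Poly
  P −P Q = P +P (K.- K.1#) ·P Q

  −P-zero⇒≋ : ∀ P Q → P −P Q ≋ 0P → P ≋ Q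
  −P-zero⇒≋ P Q P−Q≋0 j = K-Group.x∙y⁻¹≈ε⇒x≈y (coeff P j) (coeff Q j) (K.trans
    (K.+-congˡ (K.sym (K-Ring.-1*x≈-x (coeff Q j))))
    (K.trans (K.sym (K.trans (coeff-+P P _ j) (K.+-congˡ (coeff-·P _ Q j)))) (P−Q≋0 j)))
    where
    module K-Group = Algebra.Properties.Group K.+-group
    module K-Ring = Algebra.Properties.Ring K.ring

  private
    Σ<-linear : ∀ n s (f g : ℕ → Carrier) → Σ< n (λ i → f i + s · g i) ≈ Σ< n f + s · Σ< n g
    Σ<-linear n s f g = trans (Σ<-distrib-+ n f _) (+-congˡ (sym (*-distribˡ-Σ< n (ι s) g)))

    xPz-−P : ∀ i k P Q → xPz i (P −P Q) k ≈ xPz i P k + (K.- K.1#) · xPz i Q k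
    xPz-−P i k P Q = trans (xPz-+P i k P _) (+-congˡ (xPz-·P i k _ Q))

    ≈⇒+−1·≈0 : ∀ {S T} → S ≈ T → S + (K.- K.1#) · T ≈ 0#
    ≈⇒+−1·≈0 {S} {T} S≈T = begin
      S + (K.- K.1#) · T          ≈⟨ +-congʳ (trans S≈T (sym (·-identityˡ T))) ⟩
      K.1# · T + (K.- K.1#) · T   ≈⟨ ·-distribʳ _ _ T ⟩
      (K.1# K.+ K.- K.1#) · T     ≈⟨ ·-congʳ T (K.-‿inverseʳ K.1#) ⟩
      K.0# · T                    ≈⟨ ·-zeroˡ T ⟩
      0#                          ∎

  diag-unique : ∀ a b (F G : ℕ → Poly) → diag a b F ≈ diag a b G → ∀ l → l ≤ a ⊓ b → F l ≋ G l
  diag-unique a b F G F≈G l l≤ = −P-zero⇒≋ (F l) (G l) (diag-zero a b (λ l → F l −P G l) difference≈0 l l≤)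
    where
    difference≈0 : diag a b (λ l → F l −P G l) ≈ 0#
    difference≈0 = trans (trans (Σ<-cong′ (suc (a ⊓ b)) (λ l → xPz-−P (a ∸ l) (b ∸ l) (F l) (G l)))
                                (Σ<-linear (suc (a ⊓ b)) (K.- K.1#) (term F) (term G)))
                         (≈⇒+−1·≈0 F≈G)
      where
      term : (ℕ → Poly) → ℕ → Carrier
      term H l = xPz (a ∸ l) (H l) (b ∸ l)

  tri-unique : ∀ n (F G : ℕ → ℕ → Poly) → tri n F ≈ tri n G → ∀ i k → i ℕ.+ k ≤ n → F i k ≋ G i k
  tri-unique n F G F≈G i k i+k≤n = −P-zero⇒≋ (F i k) (G i k) (tri-zero n (λ i k → F i k −P G i k) difference≈0 i k i+k≤n)
    where
    difference≈0 : tri n (λ i k → F i k −P G i k) ≈ 0#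
    difference≈0 = trans (trans (Σ<-cong′ (suc n) (λ i → trans (Σ<-cong′ (suc (n ∸ i)) (λ k → xPz-−P i k (F i k) (G i k)))
                                                            (Σ<-linear (suc (n ∸ i)) (K.- K.1#) (row F i) (row G i))))
                                (Σ<-linear (suc n) (K.- K.1#) (λ i → Σ< (suc (n ∸ i)) (row F i)) (λ i → Σ< (suc (n ∸ i)) (row G i))))
                         (≈⇒+−1·≈0 F≈G)
      where
      row : (ℕ → ℕ → Poly) → ℕ → ℕ → Carrier
      row H i k = xPz i (H i k) k

  z-*-xPz : ∀ i P k → z * xPz i P k ≈ xPz i (β^ i ·P P) (suc k) + xPz (i ∸ 1) (Y* ([ i ]β ·P P)) k
  z-*-xPz i P k = begin
    z * (x ^ i * ⟦ P ⟧ * z ^ k)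
      ≈⟨ trans (*-congˡ (*-assoc _ _ _)) (sym (trans (*-assoc _ _ _) (*-assoc _ _ _))) ⟩
    z * x ^ i * ⟦ P ⟧ * z ^ k                                    ≈⟨ *-congʳ (*-congʳ (zx^ i)) ⟩
    (β^ i · (x ^ i * z) + [ i ]β · (x ^ (i ∸ 1) * y)) * ⟦ P ⟧ * z ^ k
                                                                 ≈⟨ trans (*-congʳ (distribʳ _ _ _)) (distribʳ _ _ _) ⟩
    β^ i · (x ^ i * z) * ⟦ P ⟧ * z ^ k + [ i ]β · (x ^ (i ∸ 1) * y) * ⟦ P ⟧ * z ^ k
                                                                 ≈⟨ +-cong (trans (·-assocᵐ _ _ _ _) (*-congˡ moveZ))
                                                                           (trans (·-assocᵐ _ _ _ _) (*-congˡ (*-congʳ (*-assoc _ _ _)))) ⟩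
    β^ i · xPz i P (suc k) + [ i ]β · (x ^ (i ∸ 1) * (y * ⟦ P ⟧) * z ^ k)
                                                                 ≈⟨ +-cong (sym (xPz-·P i (suc k) _ P)) (sym (·-pullᵐ _ _ _ _)) ⟩
    xPz i (β^ i ·P P) (suc k) + x ^ (i ∸ 1) * ([ i ]β · (y * ⟦ P ⟧)) * z ^ k
                                                                 ≈⟨ +-congˡ (*-congᵐ (sym ⟦Y*·P⟧)) ⟩
    xPz i (β^ i ·P P) (suc k) + xPz (i ∸ 1) (Y* ([ i ]β ·P P)) k ∎
    where
    moveZ : x ^ i * z * ⟦ P ⟧ * z ^ k ≈ x ^ i * ⟦ P ⟧ * z ^ suc k
    moveZ = begin
      x ^ i * z * ⟦ P ⟧ * z ^ k      ≈⟨ *-congʳ (trans (*-assoc _ _ _) (*-congˡ (sym (⟦⟧z≈z⟦⟧ P)))) ⟩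
      x ^ i * (⟦ P ⟧ * z) * z ^ k    ≈⟨ trans (*-congʳ (sym (*-assoc _ _ _))) (*-assoc _ _ _) ⟩
      x ^ i * ⟦ P ⟧ * (z * z ^ k)    ∎
    ⟦Y*·P⟧ : ⟦ Y* ([ i ]β ·P P) ⟧ ≈ [ i ]β · (y * ⟦ P ⟧)
    ⟦Y*·P⟧ = trans (⟦Y*⟧ ([ i ]β ·P P)) (trans (*-congˡ (⟦·P⟧ _ P)) (·-central _ _ _))

  xPz-*-x : ∀ i P k → xPz i P k * x ≈ xPz (suc i) (β^ k ·P P) k + xPz i (Y* ([ k ]β ·P P)) (k ∸ 1)
  xPz-*-x i P k = begin
    x ^ i * ⟦ P ⟧ * z ^ k * x                                    ≈⟨ *-assoc _ _ _ ⟩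
    x ^ i * ⟦ P ⟧ * (z ^ k * x)                                  ≈⟨ *-congˡ (z^x k) ⟩
    x ^ i * ⟦ P ⟧ * (β^ k · (x * z ^ k) + [ k ]β · (y * z ^ (k ∸ 1)))
                                                                 ≈⟨ distribˡ _ _ _ ⟩
    x ^ i * ⟦ P ⟧ * (β^ k · (x * z ^ k)) + x ^ i * ⟦ P ⟧ * ([ k ]β · (y * z ^ (k ∸ 1)))
                                                                 ≈⟨ +-cong (trans (·-central _ _ _) (*-congˡ moveX))
                                                                           (trans (·-central _ _ _) (*-congˡ moveY)) ⟩
    β^ k · xPz (suc i) P k + [ k ]β · xPz i (Y* P) (k ∸ 1)       ≈⟨ +-cong (sym (xPz-·P (suc i) k _ P)) (sym (xPz-·P i (k ∸ 1) _ (Y* P))) ⟩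
    xPz (suc i) (β^ k ·P P) k + xPz i ([ k ]β ·P Y* P) (k ∸ 1)   ≈⟨ +-congˡ (xPz-cong i (k ∸ 1) ([ k ]β ·P Y* P) (Y* ([ k ]β ·P P)) ·P-Y*) ⟩
    xPz (suc i) (β^ k ·P P) k + xPz i (Y* ([ k ]β ·P P)) (k ∸ 1) ∎
    where
    moveX : x ^ i * ⟦ P ⟧ * (x * z ^ k) ≈ x ^ suc i * ⟦ P ⟧ * z ^ k
    moveX = begin
      x ^ i * ⟦ P ⟧ * (x * z ^ k)   ≈⟨ sym (*-assoc _ _ _) ⟩
      x ^ i * ⟦ P ⟧ * x * z ^ k     ≈⟨ *-congʳ (trans (*-assoc _ _ _) (*-congˡ (⟦⟧x≈x⟦⟧ P))) ⟩
      x ^ i * (x * ⟦ P ⟧) * z ^ k   ≈⟨ *-congʳ (trans (sym (*-assoc _ _ _)) (*-congʳ (sym (^-sucʳ x i)))) ⟩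
      x ^ suc i * ⟦ P ⟧ * z ^ k     ∎
    moveY : x ^ i * ⟦ P ⟧ * (y * z ^ (k ∸ 1)) ≈ xPz i (Y* P) (k ∸ 1)
    moveY = begin
      x ^ i * ⟦ P ⟧ * (y * z ^ (k ∸ 1))   ≈⟨ sym (*-assoc _ _ _) ⟩
      x ^ i * ⟦ P ⟧ * y * z ^ (k ∸ 1)     ≈⟨ *-congʳ (trans (*-assoc _ _ _) (*-congˡ (trans (⟦⟧y≈y⟦⟧ P) (sym (⟦Y*⟧ P))))) ⟩
      xPz i (Y* P) (k ∸ 1)                ∎
    ·P-Y* : [ k ]β ·P Y* P ≋ Y* ([ k ]β ·P P)
    ·P-Y* zero = K.zeroʳ _
    ·P-Y* (suc j) = K.refl

  xPz-*-z : ∀ i P k → xPz i P k * z ≈ xPz i P (suc k)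
  xPz-*-z i P k = trans (*-assoc _ _ _) (*-congˡ (sym (^-sucʳ z k)))

  xPz-*-y^z^ : ∀ i P k m t → xPz i P k * (y ^ m * z ^ t) ≈ xPz i (Ypow m *P P) (k ℕ.+ t)
  xPz-*-y^z^ i P k m t = begin
    x ^ i * ⟦ P ⟧ * z ^ k * (y ^ m * z ^ t)       ≈⟨ *-assoc _ _ _ ⟩
    x ^ i * ⟦ P ⟧ * (z ^ k * (y ^ m * z ^ t))     ≈⟨ *-congˡ (trans (sym (*-assoc _ _ _)) (*-congʳ (sym (^-commute-^ m k yz≈zy)))) ⟩
    x ^ i * ⟦ P ⟧ * (y ^ m * z ^ k * z ^ t)       ≈⟨ *-congˡ (trans (*-assoc _ _ _) (*-congˡ (sym (^-+ z k t)))) ⟩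
    x ^ i * ⟦ P ⟧ * (y ^ m * z ^ (k ℕ.+ t))       ≈⟨ sym (*-assoc _ _ _) ⟩
    x ^ i * ⟦ P ⟧ * y ^ m * z ^ (k ℕ.+ t)         ≈⟨ *-congʳ (trans (*-assoc _ _ _) (*-congˡ ⟦P⟧y^)) ⟩
    xPz i (Ypow m *P P) (k ℕ.+ t)                 ∎
    where
    ⟦P⟧y^ : ⟦ P ⟧ * y ^ m ≈ ⟦ Ypow m *P P ⟧
    ⟦P⟧y^ = trans (sym (^-commute m (sym (⟦⟧y≈y⟦⟧ P)))) (sym (trans (⟦*P⟧ (Ypow m) P) (*-congʳ (⟦Ypow⟧ m))))

m⊓n<o⇒m<o⊎n<o : ∀ {m n o} → m ⊓ n < o → m < o ⊎ n < o
m⊓n<o⇒m<o⊎n<o {m} {n} m⊓n<o with ℕP.⊓-sel m n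
... | inj₁ m⊓n≡m = inj₁ (PE.subst (_< _) m⊓n≡m m⊓n<o)
... | inj₂ m⊓n≡n = inj₂ (PE.subst (_< _) m⊓n≡n m⊓n<o)

m⊓1+n≤1+m⊓n : ∀ m n → m ⊓ suc n ≤ suc (m ⊓ n)
m⊓1+n≤1+m⊓n zero n = z≤n
m⊓1+n≤1+m⊓n (suc m) n = s≤s (ℕP.⊓-monoˡ-≤ n (ℕP.n≤1+n m))

module Expansions {c ℓ a ℓa} {K : CommutativeRing c ℓ} {R : Ring a ℓa}
              (alg : AlgebraStr K R) (β : CommutativeRing.Carrier K) (x y z : Ring.Carrier R)
              (isA : Theory.IsA alg β x y z) where

  open NormalForms alg β x y z isA
  open import Data.Product using (_,_)
  open QNumbers K β using (zxCoeff; zxCoeff-beyond; zxCoeff-recurrence; zxCoeff-at-0; zxCoeff-suc-at-0)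

  single₀ : ℕ → Poly
  single₀ zero = 1P
  single₀ (suc _) = 0P

  diag-single₀ : ∀ a b → diag a b single₀ ≈ x ^ a * z ^ b
  diag-single₀ a b = begin
    diag a b single₀                             ≈⟨ Σ<-head (a ⊓ b) _ ⟩
    xPz a 1P b + Σ< (a ⊓ b) (λ l → xPz (a ∸ suc l) 0P (b ∸ suc l))
                                                 ≈⟨ +-congˡ (Σ<-zero (a ⊓ b) (λ l _ → *-≈0ᵐ refl)) ⟩
    xPz a 1P b + 0#                              ≈⟨ +-identityʳ _ ⟩
    x ^ a * ⟦ 1P ⟧ * z ^ b                       ≈⟨ *-congʳ (trans (*-congˡ ⟦1P⟧) (*-identityʳ _)) ⟩
    x ^ a * z ^ b                                ∎

  -- The polynomials W

  -- [m+1-l] is written [suc m ∸ l]β so that it vanishes for l > m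
  zStep : ℕ → (ℕ → Poly) → ℕ → Poly
  zStep m F l = β^ (m ∸ l) ·P F l +P Y* ([ suc m ∸ l ]β ·P prev F l)

  zStep-vanishes : ∀ m n F → VanishesAbove (m ⊓ n) F → VanishesAbove (m ⊓ suc n) (zStep m F)
  zStep-vanishes m n F F≋0 (suc l) m⊓1+n<1+l = +P-zero (β^ (m ∸ suc l) ·P F (suc l)) (Y* ([ suc m ∸ suc l ]β ·P F l))
    (·P-zeroʳ _ (F (suc l)) (F≋0 (suc l) (ℕP.≤-<-trans (ℕP.⊓-monoʳ-≤ m (ℕP.n≤1+n n)) m⊓1+n<1+l)))
    (Y*-zero ([ suc m ∸ suc l ]β ·P F l) (shifted (m⊓n<o⇒m<o⊎n<o m⊓1+n<1+l)))
    where
    shifted : m < suc l ⊎ suc n < suc l → [ suc m ∸ suc l ]β ·P F l ≋ 0P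
    shifted (inj₁ m<1+l) = ·P-zeroˡ _ (F l) (K.reflexive (PE.cong [_]β (ℕP.m≤n⇒m∸n≡0 (ℕP.≤-pred m<1+l))))
    shifted (inj₂ 1+n<1+l) = ·P-zeroʳ _ (F l) (F≋0 l (ℕP.≤-<-trans (ℕP.m⊓n≤n m n) (ℕP.≤-pred 1+n<1+l)))

  z-*-diag : ∀ m n F → VanishesAbove (m ⊓ n) F → z * diag m n F ≈ diag m (suc n) (zStep m F)
  z-*-diag m n F F≋0 = begin
    z * diag m n F                                     ≈⟨ *-distribˡ-Σ< B z _ ⟩
    Σ< B (λ l → z * xPz (m ∸ l) (F l) (n ∸ l))         ≈⟨ Σ<-cong B (λ l l<B → z-*-term l (ℕP.≤-trans (ℕP.≤-pred l<B) (ℕP.m⊓n≤n m n))) ⟩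
    Σ< B (λ l → A l + C (suc l))                       ≈⟨ Σ<-distrib-+ B A (C ∘ suc) ⟩
    Σ< B A + Σ< B (C ∘ suc)                            ≈⟨ +-cong (sym (trans (+-congˡ A-last≈0) (+-identityʳ _))) (Σ<-shift B C C0≈0) ⟩
    Σ< (suc B) A + Σ< (suc B) C                        ≈⟨ sym (Σ<-distrib-+ (suc B) A C) ⟩
    Σ< (suc B) (λ l → A l + C l)
      ≈⟨ Σ<-cong′ (suc B) (λ l → sym (xPz-+P (m ∸ l) (suc n ∸ l) (β^ (m ∸ l) ·P F l) (Y* ([ suc m ∸ l ]β ·P prev F l)))) ⟩
    Σ< (suc B) (λ l → xPz (m ∸ l) (zStep m F l) (suc n ∸ l))
                                                       ≈⟨ Σ<-support (suc B) _ (m ⊓ suc n) (s≤s (m⊓1+n≤1+m⊓n m n)) ℕP.≤-refl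
                                                            (λ l above → xPz-zero (m ∸ l) (suc n ∸ l) (zStep m F l) (zStep-vanishes m n F F≋0 l above)) ⟩
    diag m (suc n) (zStep m F)                         ∎
    where
    B = suc (m ⊓ n)
    A C : ℕ → Carrier
    A l = xPz (m ∸ l) (β^ (m ∸ l) ·P F l) (suc n ∸ l)
    C l = xPz (m ∸ l) (Y* ([ suc m ∸ l ]β ·P prev F l)) (suc n ∸ l)
    A-last≈0 : A B ≈ 0#
    A-last≈0 = xPz-zero (m ∸ B) (suc n ∸ B) (β^ (m ∸ B) ·P F B) (·P-zeroʳ _ (F B) (F≋0 B ℕP.≤-refl))
    C0≈0 : C 0 ≈ 0#
    C0≈0 = xPz-zero m (suc n) (Y* ([ suc m ]β ·P [])) (Y*-zero ([ suc m ]β ·P []) (·P-zeroʳ [ suc m ]β [] (≋-refl [])))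
    z-*-term : ∀ l → l ≤ n → z * xPz (m ∸ l) (F l) (n ∸ l) ≈ A l + C (suc l)
    z-*-term l l≤n = trans (z-*-xPz (m ∸ l) (F l) (n ∸ l)) (≡⇒≈ (PE.cong₂ _+_
      (PE.cong (xPz (m ∸ l) (β^ (m ∸ l) ·P F l)) (PE.sym (ℕP.+-∸-assoc 1 l≤n)))
      (PE.cong (λ i → xPz i (Y* ([ m ∸ l ]β ·P F l)) (n ∸ l)) (PE.trans (ℕP.∸-+-assoc m l 1) (PE.cong (m ∸_) (ℕP.+-comm l 1))))))

  W : ℕ → ℕ → ℕ → Poly
  W m zero = single₀
  W m (suc n) = zStep m (W m n)

  W-vanishes : ∀ m n → VanishesAbove (m ⊓ n) (W m n)
  W-vanishes m zero zero m⊓0<0 = ⊥-elim (ℕP.n≮0 m⊓0<0)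
  W-vanishes m zero (suc l) _ = ≋-refl 0P
  W-vanishes m (suc n) = zStep-vanishes m n (W m n) (W-vanishes m n)

  WExp-W : ∀ m n → WExp m n (W m n)
  WExp-W m zero = begin
    1# * x ^ m        ≈⟨ trans (*-identityˡ _) (sym (*-identityʳ _)) ⟩
    x ^ m * z ^ 0     ≈⟨ sym (diag-single₀ m 0) ⟩
    diag m 0 single₀  ∎
  WExp-W m (suc n) = begin
    z * z ^ n * x ^ m          ≈⟨ *-assoc _ _ _ ⟩
    z * (z ^ n * x ^ m)        ≈⟨ *-congˡ (WExp-W m n) ⟩
    z * diag m n (W m n)       ≈⟨ z-*-diag m n (W m n) (W-vanishes m n) ⟩
    diag m (suc n) (W m (suc n)) ∎

  WProps-W : WProps W
  WProps-W = WExp-W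
           , (λ m n F F-exp → diag-unique m n F (W m n) (trans (sym F-exp) (WExp-W m n)))
           , W-vanishes
           , (λ m → ≋-refl 1P)
           , (λ { m (suc k) _ → ≋-refl 0P })
           , (λ m n k k≤m → PE.subst (λ j → W m (suc n) k ≋ β^ (m ∸ k) ·P W m n k +P Y* ([ j ]β ·P prev (W m n) k))
                                     (PE.trans (ℕP.+-∸-assoc 1 k≤m) (ℕP.+-comm 1 (m ∸ k))) (≋-refl (W m (suc n) k)))

  -- The explicit formula for z^n x^m

  zxTerm : ℕ → ℕ → ℕ → Carrier
  zxTerm n m k = zxCoeff n m k · mono (m ∸ k) k (n ∸ k)

  private
    single-term : ∀ {c r} → c K.≈ K.1# → r ≈ Σ< 1 (λ _ → c · r)
    single-term {c} {r} c≈1 = sym (trans (+-identityˡ _) (trans (·-congʳ r c≈1) (·-identityˡ r)))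

    ·-Σ< : ∀ c u n f → c · (u * Σ< n f) ≈ Σ< n (λ k → c · (u * f k))
    ·-Σ< c u n f = trans (*-congˡ (*-distribˡ-Σ< n u f)) (*-distribˡ-Σ< n (ι c) _)

    x-*-term : ∀ c d i j k → c · (x * (d · mono i j k)) ≈ (c K.* d) · mono (suc i) j k
    x-*-term c d i j k = begin
      c · (x * (d · mono i j k))          ≈⟨ *-congˡ (·-central d x _) ⟩
      c · (d · (x * mono i j k))          ≈⟨ ·-assoc c d _ ⟩
      (c K.* d) · (x * mono i j k)        ≈⟨ *-congˡ (trans (sym (*-assoc _ _ _)) (*-congʳ (sym (*-assoc _ _ _)))) ⟩
      (c K.* d) · mono (suc i) j k        ∎

    y-*-term : ∀ c d i j k → c · (y * (d · mono i j k)) ≈ (c K.* d) · mono i (suc j) k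
    y-*-term c d i j k = begin
      c · (y * (d · mono i j k))          ≈⟨ *-congˡ (·-central d y _) ⟩
      c · (d · (y * mono i j k))          ≈⟨ ·-assoc c d _ ⟩
      (c K.* d) · (y * mono i j k)        ≈⟨ *-congˡ (trans (sym (*-assoc _ _ _)) (*-congʳ (sym (*-assoc _ _ _)))) ⟩
      (c K.* d) · (y * x ^ i * y ^ j * z ^ k)
                                          ≈⟨ *-congˡ (*-congʳ (trans (*-congʳ (sym (^-commute i xy≈yx))) (*-assoc _ _ _))) ⟩
      (c K.* d) · mono i (suc j) k        ∎

  explicit : ∀ m n → z ^ n * x ^ m ≈ Σ< (suc (m ⊓ n)) (zxTerm n m)
  explicit zero n = trans (trans (*-identityʳ _) (sym (trans (*-congʳ (*-identityˡ _)) (*-identityˡ _))))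
                          (single-term (zxCoeff-at-0 n 0))
  explicit (suc m) zero = trans (trans (*-identityˡ _) (sym (trans (*-identityʳ _) (*-identityʳ _))))
                                (single-term (K.trans (zxCoeff-at-0 0 (suc m)) (K.reflexive (PE.cong β^ (ℕP.*-zeroʳ m)))))
  explicit (suc m) (suc n′) = begin
    z ^ n * (x * x ^ m)                                              ≈⟨ sym (*-assoc _ _ _) ⟩
    z ^ n * x * x ^ m                                                ≈⟨ *-congʳ (z^x n) ⟩
    (β^ n · (x * z ^ n) + [ n ]β · (y * z ^ n′)) * x ^ m             ≈⟨ distribʳ _ _ _ ⟩
    β^ n · (x * z ^ n) * x ^ m + [ n ]β · (y * z ^ n′) * x ^ m       ≈⟨ +-cong reassoc reassoc ⟩
    β^ n · (x * (z ^ n * x ^ m)) + [ n ]β · (y * (z ^ n′ * x ^ m))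
      ≈⟨ +-cong (*-congˡ (*-congˡ (explicit m n))) (*-congˡ (*-congˡ (explicit m n′))) ⟩
    β^ n · (x * Σ< (suc (m ⊓ n)) (zxTerm n m)) + [ n ]β · (y * Σ< (suc (m ⊓ n′)) (zxTerm n′ m))
                                                                     ≈⟨ +-cong (·-Σ< (β^ n) x (suc (m ⊓ n)) (zxTerm n m)) (·-Σ< [ n ]β y (suc (m ⊓ n′)) (zxTerm n′ m)) ⟩
    Σ< (suc (m ⊓ n)) (λ k → β^ n · (x * zxTerm n m k)) + Σ< (suc (m ⊓ n′)) (λ k → [ n ]β · (y * zxTerm n′ m k))
                                                                     ≈⟨ +-cong (Σ<-cong′ (suc (m ⊓ n)) x-step) (Σ<-cong′ (suc (m ⊓ n′)) (λ k → y-*-term [ n ]β (zxCoeff n′ m k) (m ∸ k) k (n′ ∸ k))) ⟩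
    Σ< (suc (m ⊓ n)) A + Σ< (suc (m ⊓ n′)) (C ∘ suc)                 ≈⟨ +-cong (sym (Σ<-truncate (suc (m ⊓ n)) B (s≤s (m⊓1+n≤1+m⊓n m n′)) A-beyond))
                                                                                (Σ<-shift (suc (m ⊓ n′)) C refl) ⟩
    Σ< B A + Σ< B C                                                  ≈⟨ sym (Σ<-distrib-+ B A C) ⟩
    Σ< B (λ k → A k + C k)                                           ≈⟨ Σ<-cong′ B combine ⟩
    Σ< B (zxTerm n (suc m))                                          ∎
    where
    n = suc n′
    B = suc (suc (m ⊓ n′))
    A C : ℕ → Carrier
    A k = (β^ n K.* zxCoeff n m k) · mono (suc m ∸ k) k (n ∸ k)
    C zero = 0#
    C (suc k) = ([ n ]β K.* zxCoeff n′ m k) · mono (m ∸ k) (suc k) (n′ ∸ k)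
    reassoc : ∀ {c u v w} → c · (u * v) * w ≈ c · (u * (v * w))
    reassoc = trans (*-assoc _ _ _) (*-congˡ (*-assoc _ _ _))
    coeff-beyond≈0 : ∀ k → m ⊓ n < k → (β^ n K.* zxCoeff n m k) K.≈ K.0#
    coeff-beyond≈0 k m⊓n<k = K.trans (K.*-congˡ (zxCoeff-beyond n m k m⊓n<k)) (K.zeroʳ _)
    A-beyond : ∀ k → suc (m ⊓ n) ≤ k → k < B → A k ≈ 0#
    A-beyond k m⊓n<k _ = trans (·-congʳ _ (coeff-beyond≈0 k m⊓n<k)) (·-zeroˡ _)
    x-step : ∀ k → β^ n · (x * zxTerm n m k) ≈ A k
    x-step k with ℕP.≤-<-connex k m
    ... | inj₁ k≤m = trans (x-*-term (β^ n) (zxCoeff n m k) (m ∸ k) k (n ∸ k))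
                           (≡⇒≈ (PE.cong (λ i → (β^ n K.* zxCoeff n m k) · mono i k (n ∸ k)) (PE.sym (ℕP.+-∸-assoc 1 k≤m))))
    ... | inj₂ m<k = trans (x-*-term (β^ n) (zxCoeff n m k) (m ∸ k) k (n ∸ k))
                           (trans (zero-coeff (suc (m ∸ k))) (sym (zero-coeff (suc m ∸ k))))
      where
      zero-coeff : ∀ i → (β^ n K.* zxCoeff n m k) · mono i k (n ∸ k) ≈ 0#
      zero-coeff i = trans (·-congʳ _ (coeff-beyond≈0 k (ℕP.≤-<-trans (ℕP.m⊓n≤m m n) m<k))) (·-zeroˡ _)
    combine : ∀ k → A k + C k ≈ zxTerm n (suc m) k
    combine zero = trans (+-identityʳ _) (·-congʳ _ (zxCoeff-suc-at-0 n m))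
    combine (suc k) = trans (·-distribʳ _ _ _) (·-congʳ _ (zxCoeff-recurrence n′ m k))

  -- Multiplying a diagonal sum by x^n y^m z^t on the right

  convW : ℕ → ℕ → (ℕ → Poly) → ℕ → Poly
  convW n b F l = ΣP (suc (n ⊓ l)) (λ k → F (l ∸ k) *P W n (b ∸ (l ∸ k)) k)

  W-vanishesʳ : ∀ n j k → n < k → W n j k ≋ 0P
  W-vanishesʳ n j k n<k = W-vanishes n j k (ℕP.≤-<-trans (ℕP.m⊓n≤m n j) n<k)

  convW-vanishes : ∀ a b n F → VanishesAbove (a ⊓ b) F → VanishesAbove ((a ℕ.+ n) ⊓ b) (convW n b F)
  convW-vanishes a b n F F≋0 l above = ΣP-zero (suc (n ⊓ l)) _ term≋0
    where
    term≋0 : ∀ k → k < suc (n ⊓ l) → F (l ∸ k) *P W n (b ∸ (l ∸ k)) k ≋ 0P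
    term≋0 k k<1+n⊓l with ℕP.≤-<-connex (l ∸ k) (a ⊓ b) | ℕP.≤-<-connex k (b ∸ (l ∸ k))
    ... | inj₂ a⊓b<l∸k | _ = *P-zeroˡ (F (l ∸ k)) _ (F≋0 (l ∸ k) a⊓b<l∸k)
    ... | inj₁ _ | inj₂ b∸[l∸k]<k = *P-zeroʳ (F (l ∸ k)) _
                                      (W-vanishes n _ k (ℕP.≤-<-trans (ℕP.m⊓n≤n n _) b∸[l∸k]<k))
    ... | inj₁ l∸k≤a⊓b | inj₁ k≤b∸[l∸k] = ⊥-elim (ℕP.<⇒≱ above (ℕP.⊓-glb l≤a+n l≤b))
      where
      k≤n⊓l = ℕP.≤-pred k<1+n⊓l
      l∸k+k≡l : l ∸ k ℕ.+ k ≡ l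
      l∸k+k≡l = ℕP.m∸n+n≡m (ℕP.≤-trans k≤n⊓l (ℕP.m⊓n≤n n l))
      l≤a+n : l ≤ a ℕ.+ n
      l≤a+n = PE.subst (_≤ a ℕ.+ n) l∸k+k≡l
                (ℕP.+-mono-≤ (ℕP.≤-trans l∸k≤a⊓b (ℕP.m⊓n≤m a b)) (ℕP.≤-trans k≤n⊓l (ℕP.m⊓n≤m n l)))
      l≤b : l ≤ b
      l≤b = PE.subst (_≤ b) l∸k+k≡l (PE.subst (l ∸ k ℕ.+ k ≤_) (ℕP.m+[n∸m]≡n (ℕP.≤-trans l∸k≤a⊓b (ℕP.m⊓n≤n a b)))
                                               (ℕP.+-monoʳ-≤ (l ∸ k) k≤b∸[l∸k]))

  xP-*-xPz : ∀ i P a Q b → x ^ i * ⟦ P ⟧ * xPz a Q b ≈ xPz (i ℕ.+ a) (P *P Q) b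
  xP-*-xPz i P a Q b = begin
    x ^ i * ⟦ P ⟧ * (x ^ a * ⟦ Q ⟧ * z ^ b)     ≈⟨ sym (*-assoc _ _ _) ⟩
    x ^ i * ⟦ P ⟧ * (x ^ a * ⟦ Q ⟧) * z ^ b     ≈⟨ *-congʳ (trans (*-assoc _ _ _) (*-congˡ (sym (*-assoc _ _ _)))) ⟩
    x ^ i * (⟦ P ⟧ * x ^ a * ⟦ Q ⟧) * z ^ b     ≈⟨ *-congᵐ (*-congʳ (sym (^-commute a (sym (⟦⟧x≈x⟦⟧ P))))) ⟩
    x ^ i * (x ^ a * ⟦ P ⟧ * ⟦ Q ⟧) * z ^ b     ≈⟨ *-congʳ (trans (*-congˡ (*-assoc _ _ _)) (sym (*-assoc _ _ _))) ⟩
    x ^ i * x ^ a * (⟦ P ⟧ * ⟦ Q ⟧) * z ^ b     ≈⟨ *-congʳ (*-cong (sym (^-+ x i a)) (sym (⟦*P⟧ P Q))) ⟩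
    xPz (i ℕ.+ a) (P *P Q) b                     ∎

  xPz-*-x^ : ∀ i P k n → xPz i P k * x ^ n ≈ Σ< (suc (n ⊓ k)) (λ j → xPz (i ℕ.+ (n ∸ j)) (P *P W n k j) (k ∸ j))
  xPz-*-x^ i P k n = begin
    x ^ i * ⟦ P ⟧ * z ^ k * x ^ n                                      ≈⟨ *-assoc _ _ _ ⟩
    x ^ i * ⟦ P ⟧ * (z ^ k * x ^ n)                                    ≈⟨ *-congˡ (WExp-W n k) ⟩
    x ^ i * ⟦ P ⟧ * diag n k (W n k)                                   ≈⟨ *-distribˡ-Σ< (suc (n ⊓ k)) _ _ ⟩
    Σ< (suc (n ⊓ k)) (λ j → x ^ i * ⟦ P ⟧ * xPz (n ∸ j) (W n k j) (k ∸ j))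
                                                                       ≈⟨ Σ<-cong′ (suc (n ⊓ k)) (λ j → xP-*-xPz i P (n ∸ j) (W n k j) (k ∸ j)) ⟩
    Σ< (suc (n ⊓ k)) (λ j → xPz (i ℕ.+ (n ∸ j)) (P *P W n k j) (k ∸ j)) ∎

  diag-*-x^ : ∀ a b n F → VanishesAbove (a ⊓ b) F → diag a b F * x ^ n ≈ diag (a ℕ.+ n) b (convW n b F)
  diag-*-x^ a b n F F≋0 = begin
    diag a b F * x ^ n                                        ≈⟨ *-distribʳ-Σ< B _ _ ⟩
    Σ< B (λ l → xPz (a ∸ l) (F l) (b ∸ l) * x ^ n)            ≈⟨ Σ<-cong B (λ l l<B → row l (ℕP.≤-pred l<B)) ⟩
    Σ< B (λ l → Σ< (suc n) (h l))
      ≈⟨ sym (Σ<-truncate B N (ℕP.m≤m+n B (suc n)) (λ l B≤l _ → Σ<-zero (suc n) (λ k _ → h-zeroˡ l k B≤l))) ⟩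
    Σ< N (λ l → Σ< (suc n) (h l))
      ≈⟨ Σ<-cong′ N (λ l → sym (Σ<-truncate (suc n) N (ℕP.m≤n+m (suc n) B) (λ k n<k _ → h-zeroʳ l k n<k))) ⟩
    Σ< N (λ l → Σ< N (h l))                                   ≈⟨ Σ<-antidiagonals N h h-zero ⟩
    Σ< (N ℕ.+ N) (λ L → Σ< (suc L) (λ k → h (L ∸ k) k))       ≈⟨ Σ<-cong′ (N ℕ.+ N) antidiagonal ⟩
    Σ< (N ℕ.+ N) (λ L → xPz (a ℕ.+ n ∸ L) (convW n b F L) (b ∸ L))
                                                              ≈⟨ Σ<-support (N ℕ.+ N) _ ((a ℕ.+ n) ⊓ b) bound ℕP.≤-refl
                                                                   (λ L above → xPz-zero (a ℕ.+ n ∸ L) (b ∸ L) (convW n b F L) (convW-vanishes a b n F F≋0 L above)) ⟩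
    diag (a ℕ.+ n) b (convW n b F)                            ∎
    where
    B = suc (a ⊓ b)
    N = B ℕ.+ suc n
    h : ℕ → ℕ → Carrier
    h l k = xPz (a ℕ.+ n ∸ (l ℕ.+ k)) (F l *P W n (b ∸ l) k) (b ∸ (l ℕ.+ k))
    h-zeroˡ : ∀ l k → B ≤ l → h l k ≈ 0#
    h-zeroˡ l k a⊓b<l = xPz-zero (a ℕ.+ n ∸ (l ℕ.+ k)) (b ∸ (l ℕ.+ k)) (F l *P W n (b ∸ l) k) (*P-zeroˡ (F l) _ (F≋0 l a⊓b<l))
    h-zeroʳ : ∀ l k → n < k → h l k ≈ 0#
    h-zeroʳ l k n<k = xPz-zero (a ℕ.+ n ∸ (l ℕ.+ k)) (b ∸ (l ℕ.+ k)) (F l *P W n (b ∸ l) k) (*P-zeroʳ (F l) _ (W-vanishesʳ n (b ∸ l) k n<k))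
    h-zero : ∀ l k → N ≤ l ⊎ N ≤ k → h l k ≈ 0#
    h-zero l k (inj₁ N≤l) = h-zeroˡ l k (ℕP.≤-trans (ℕP.m≤m+n B (suc n)) N≤l)
    h-zero l k (inj₂ N≤k) = h-zeroʳ l k (ℕP.≤-trans (ℕP.m≤n+m (suc n) B) N≤k)
    bound : (a ℕ.+ n) ⊓ b < N ℕ.+ N
    bound = ℕP.≤-trans (s≤s (ℕP.≤-trans (ℕP.⊓-monoʳ-≤ (a ℕ.+ n) (ℕP.m≤m+n b n)) (ℕP.≤-reflexive (PE.sym (ℕP.+-distribʳ-⊓ n a b)))))
                       (ℕP.≤-trans (s≤s (ℕP.+-monoʳ-≤ (a ⊓ b) (ℕP.n≤1+n n))) (ℕP.m≤m+n N N))
    row : ∀ l → l ≤ a ⊓ b → xPz (a ∸ l) (F l) (b ∸ l) * x ^ n ≈ Σ< (suc n) (h l)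
    row l l≤a⊓b = begin
      xPz (a ∸ l) (F l) (b ∸ l) * x ^ n          ≈⟨ xPz-*-x^ (a ∸ l) (F l) (b ∸ l) n ⟩
      Σ< (suc (n ⊓ (b ∸ l))) (λ k → xPz (a ∸ l ℕ.+ (n ∸ k)) (F l *P W n (b ∸ l) k) (b ∸ l ∸ k))
                                                 ≈⟨ Σ<-cong (suc (n ⊓ (b ∸ l))) (λ k k< → ≡⇒≈ (PE.cong₂ (λ i j → xPz i (F l *P W n (b ∸ l) k) j)
                                                      (exponent (ℕP.≤-trans (ℕP.≤-pred k<) (ℕP.m⊓n≤m n (b ∸ l)))) (ℕP.∸-+-assoc b l k))) ⟩
      Σ< (suc (n ⊓ (b ∸ l))) (h l)               ≈⟨ sym (Σ<-truncate (suc (n ⊓ (b ∸ l))) (suc n) (s≤s (ℕP.m⊓n≤m n (b ∸ l)))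
                                                      (λ k above _ → xPz-zero (a ℕ.+ n ∸ (l ℕ.+ k)) (b ∸ (l ℕ.+ k)) (F l *P W n (b ∸ l) k) (*P-zeroʳ (F l) _ (W-vanishes n (b ∸ l) k above)))) ⟩
      Σ< (suc n) (h l)                           ∎
      where
      l≤a = ℕP.≤-trans l≤a⊓b (ℕP.m⊓n≤m a b)
      exponent : ∀ {k} → k ≤ n → a ∸ l ℕ.+ (n ∸ k) ≡ a ℕ.+ n ∸ (l ℕ.+ k)
      exponent {k} k≤n = PE.sym (PE.trans (PE.sym (ℕP.∸-+-assoc (a ℕ.+ n) l k))
        (PE.trans (PE.cong (_∸ k) (ℕP.+-∸-comm n l≤a)) (ℕP.+-∸-assoc (a ∸ l) k≤n)))
    antidiagonal : ∀ L → Σ< (suc L) (λ k → h (L ∸ k) k) ≈ xPz (a ℕ.+ n ∸ L) (convW n b F L) (b ∸ L)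
    antidiagonal L = begin
      Σ< (suc L) (λ k → h (L ∸ k) k)             ≈⟨ Σ<-cong (suc L) (λ k k≤L → ≡⇒≈ (PE.cong (λ j → xPz (a ℕ.+ n ∸ j) (term k) (b ∸ j))
                                                                                     (ℕP.m∸n+n≡m (ℕP.≤-pred k≤L)))) ⟩
      Σ< (suc L) (λ k → xPz (a ℕ.+ n ∸ L) (term k) (b ∸ L))
                                                 ≈⟨ Σ<-truncate (suc (n ⊓ L)) (suc L) (s≤s (ℕP.m⊓n≤n n L))
                                                      (λ k above k≤L → xPz-zero (a ℕ.+ n ∸ L) (b ∸ L) (term k) (*P-zeroʳ (F (L ∸ k)) _
                                                         (W-vanishesʳ n (b ∸ (L ∸ k)) k (beyond-n k above (ℕP.≤-pred k≤L))))) ⟩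
      Σ< (suc (n ⊓ L)) (λ k → xPz (a ℕ.+ n ∸ L) (term k) (b ∸ L))
                                                 ≈⟨ sym (trans (*-congᵐ (⟦ΣP⟧ (suc (n ⊓ L)) term)) (*-distribᵐ-Σ< _ _ (suc (n ⊓ L)) _)) ⟩
      xPz (a ℕ.+ n ∸ L) (convW n b F L) (b ∸ L)  ∎
      where
      term : ℕ → Poly
      term k = F (L ∸ k) *P W n (b ∸ (L ∸ k)) k
      beyond-n : ∀ k → n ⊓ L < k → k ≤ L → n < k
      beyond-n k n⊓L<k k≤L with m⊓n<o⇒m<o⊎n<o n⊓L<k
      ... | inj₁ n<k = n<k
      ... | inj₂ L<k = ⊥-elim (ℕP.<⇒≱ L<k k≤L)

  diag-*-xyz : ∀ a b n m t F → VanishesAbove (a ⊓ b) F →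
    diag a b F * (x ^ n * y ^ m * z ^ t) ≈ diag (a ℕ.+ n) (b ℕ.+ t) (λ l → Ypow m *P convW n b F l)
  diag-*-xyz a b n m t F F≋0 = begin
    diag a b F * (x ^ n * y ^ m * z ^ t)                      ≈⟨ trans (*-congˡ (*-assoc _ _ _)) (sym (*-assoc _ _ _)) ⟩
    diag a b F * x ^ n * (y ^ m * z ^ t)                      ≈⟨ *-congʳ (diag-*-x^ a b n F F≋0) ⟩
    diag (a ℕ.+ n) b G * (y ^ m * z ^ t)                      ≈⟨ *-distribʳ-Σ< B _ _ ⟩
    Σ< B (λ l → xPz (a ℕ.+ n ∸ l) (G l) (b ∸ l) * (y ^ m * z ^ t))
                                                              ≈⟨ Σ<-cong B (λ l l<B → trans (xPz-*-y^z^ (a ℕ.+ n ∸ l) (G l) (b ∸ l) m t)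
                                                                   (≡⇒≈ (PE.cong (xPz (a ℕ.+ n ∸ l) (Ypow m *P G l)) (PE.sym (ℕP.+-∸-comm t (l≤b l<B)))))) ⟩
    Σ< B (λ l → xPz (a ℕ.+ n ∸ l) (Ypow m *P G l) (b ℕ.+ t ∸ l))
                                                              ≈⟨ Σ<-support B _ ((a ℕ.+ n) ⊓ b) ℕP.≤-refl (s≤s (ℕP.⊓-monoʳ-≤ (a ℕ.+ n) (ℕP.m≤m+n b t)))
                                                                   (λ l above → xPz-zero (a ℕ.+ n ∸ l) (b ℕ.+ t ∸ l) (Ypow m *P G l)
                                                                                  (*P-zeroʳ (Ypow m) (G l) (convW-vanishes a b n F F≋0 l above))) ⟩
    diag (a ℕ.+ n) (b ℕ.+ t) (λ l → Ypow m *P G l)           ∎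
    where
    G = convW n b F
    B = suc ((a ℕ.+ n) ⊓ b)
    l≤b : ∀ {l} → l < B → l ≤ b
    l≤b l<B = ℕP.≤-trans (ℕP.≤-pred l<B) (ℕP.m⊓n≤n _ b)

  single₀-suc : ∀ j → 0 < j → single₀ j ≋ 0P
  single₀-suc (suc j) _ = ≋-refl 0P

  convW-single₀ : ∀ n b l → convW n b single₀ l ≋ W n b l
  convW-single₀ n b l with ℕP.≤-<-connex l n
  ... | inj₁ l≤n = ≋-trans (convW n b single₀ l) (single₀ (l ∸ l) *P W n (b ∸ (l ∸ l)) l) (W n b l)
          (ΣP-single (suc (n ⊓ l)) l term (s≤s (ℕP.≤-reflexive (PE.sym (ℕP.m≥n⇒m⊓n≡n l≤n))))
            (λ k k<1+n⊓l k≢l → *P-zeroˡ (single₀ (l ∸ k)) _ (single₀-suc (l ∸ k) (ℕP.m<n⇒0<n∸m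
              (ℕP.≤∧≢⇒< (ℕP.≤-trans (ℕP.≤-pred k<1+n⊓l) (ℕP.m⊓n≤n n l)) k≢l)))))
          (PE.subst (λ j → single₀ j *P W n (b ∸ j) l ≋ W n b l) (PE.sym (ℕP.n∸n≡0 l)) (*P-identityˡ (W n b l)))
    where
    term : ℕ → Poly
    term k = single₀ (l ∸ k) *P W n (b ∸ (l ∸ k)) k
  ... | inj₂ n<l = ≋-trans (convW n b single₀ l) 0P (W n b l)
          (ΣP-zero (suc (n ⊓ l)) _ (λ k k<1+n⊓l → *P-zeroˡ (single₀ (l ∸ k)) _ (single₀-suc (l ∸ k) (ℕP.m<n⇒0<n∸m
            (ℕP.≤-<-trans (ℕP.≤-trans (ℕP.≤-pred k<1+n⊓l) (ℕP.m⊓n≤m n l)) n<l)))))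
          (≋-sym (W n b l) 0P (W-vanishesʳ n b l n<l))

  -- Powers of x^n y^m z^t

  Rf : ℕ → ℕ → ℕ → ℕ → ℕ → Poly
  Rf n m t zero = single₀
  Rf n m t (suc s) l = Ypow m *P convW n (t ℕ.* s) (Rf n m t s) l

  *-sucʳ : ∀ n s → n ℕ.* suc s ≡ n ℕ.* s ℕ.+ n
  *-sucʳ n s = PE.trans (ℕP.*-suc n s) (ℕP.+-comm n (n ℕ.* s))

  Rf-vanishes : ∀ n m t s → VanishesAbove ((n ℕ.* s) ⊓ (t ℕ.* s)) (Rf n m t s)
  Rf-vanishes n m t zero zero above = ⊥-elim (ℕP.n≮0 above)
  Rf-vanishes n m t zero (suc l) _ = ≋-refl 0P
  Rf-vanishes n m t (suc s) l above = *P-zeroʳ (Ypow m) _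
    (convW-vanishes (n ℕ.* s) (t ℕ.* s) n (Rf n m t s) (Rf-vanishes n m t s) l (ℕP.≤-<-trans bound above))
    where
    bound : (n ℕ.* s ℕ.+ n) ⊓ (t ℕ.* s) ≤ (n ℕ.* suc s) ⊓ (t ℕ.* suc s)
    bound rewrite *-sucʳ n s | *-sucʳ t s = ℕP.⊓-monoʳ-≤ (n ℕ.* s ℕ.+ n) (ℕP.m≤m+n (t ℕ.* s) t)

  RExp-Rf : ∀ n m t s → RExp n m t s (Rf n m t s)
  RExp-Rf n m t zero rewrite ℕP.*-zeroʳ n | ℕP.*-zeroʳ t = sym (trans (diag-single₀ 0 0) (*-identityˡ 1#))
  RExp-Rf n m t (suc s) rewrite *-sucʳ n s | *-sucʳ t s = begin
    (x ^ n * y ^ m * z ^ t) ^ suc s                                 ≈⟨ ^-sucʳ _ s ⟩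
    (x ^ n * y ^ m * z ^ t) ^ s * (x ^ n * y ^ m * z ^ t)           ≈⟨ *-congʳ (RExp-Rf n m t s) ⟩
    diag (n ℕ.* s) (t ℕ.* s) (Rf n m t s) * (x ^ n * y ^ m * z ^ t)  ≈⟨ diag-*-xyz _ _ n m t (Rf n m t s) (Rf-vanishes n m t s) ⟩
    diag (n ℕ.* s ℕ.+ n) (t ℕ.* s ℕ.+ t) (Rf n m t (suc s))          ∎

  convW-single₀-at-0 : ∀ n t l → convW n (t ℕ.* 0) single₀ l ≋ single₀ l
  convW-single₀-at-0 n t l rewrite ℕP.*-zeroʳ t = convW-single₀ n 0 l

  Rf-1-0 : ∀ n m t → Rf n m t 1 0 ≋ Ypow m
  Rf-1-0 n m t = *P-identityʳ (Ypow m) _ (convW-single₀-at-0 n t 0)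

  Rf-1-suc : ∀ n m t l → Rf n m t 1 (suc l) ≋ 0P
  Rf-1-suc n m t l = *P-zeroʳ (Ypow m) _ (convW-single₀-at-0 n t (suc l))

  Part4-Rf : Part4 W
  Part4-Rf = Rf
          , RExp-Rf
          , (λ n m t s F F-exp → diag-unique _ _ F (Rf n m t s) (trans (sym F-exp) (RExp-Rf n m t s)))
          , Rf-vanishes
          , Rf-1-0
          , (λ { n m t (suc l) _ → Rf-1-suc n m t l })
          , (λ n m t s l _ → ≋-refl (Rf n m t (suc s) l))

  Part2-Rf : Part2 W
  Part2-Rf = (λ m n s → trans (^-distrib-* s (^-commute-^ n m xy≈yx)) (*-cong (^-* x n s) (^-* y m s)))
          , (λ m n s → trans (^-distrib-* s (^-commute-^ n m yz≈zy)) (*-cong (^-* y n s) (^-* z m s)))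
          , (λ n m → Rf n 0 m)
          , UExp-U
          , (λ n m s F F-exp → diag-unique _ _ F (Rf n 0 m s) (trans (sym F-exp) (UExp-U n m s)))
          , (λ n m → Rf-vanishes n 0 m)
          , (λ n m → Rf-1-0 n 0 m)
          , (λ { n m (suc l) _ → Rf-1-suc n 0 m l })
          , (λ n m s l _ → *P-identityˡ (convW n (m ℕ.* s) (Rf n 0 m s) l))
    where
    UExp-U : ∀ n m s → UExp n m s (Rf n 0 m s)
    UExp-U n m s = trans (^-congˡ s (*-congʳ (sym (*-identityʳ _)))) (RExp-Rf n 0 m s)

  -- Powers of xyz

  V : ℕ → ℕ → Poly
  V zero = single₀
  V (suc s) l = β^ (s ∸ l) ·P Y* V s l +P [ suc s ∸ l ]β ·P Y* Y* prev (V s) l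

  V-vanishes : ∀ s → VanishesAbove s (V s)
  V-vanishes zero (suc l) _ = ≋-refl 0P
  V-vanishes (suc s) l 1+s<l = +P-zero (β^ (s ∸ l) ·P Y* V s l) ([ suc s ∸ l ]β ·P Y* Y* prev (V s) l)
    (·P-zeroʳ (β^ (s ∸ l)) (Y* V s l) (Y*-zero (V s l) (V-vanishes s l (ℕP.<-trans (ℕP.n<1+n s) 1+s<l))))
    (·P-zeroˡ [ suc s ∸ l ]β (Y* Y* prev (V s) l) (K.reflexive (PE.cong [_]β (ℕP.m≤n⇒m∸n≡0 (ℕP.<⇒≤ 1+s<l)))))

  V-diagonal : ∀ s → V (suc s) (suc s) ≋ 0P
  V-diagonal s = +P-zero (β^ (s ∸ suc s) ·P Y* V s (suc s)) ([ s ∸ s ]β ·P Y* Y* V s s)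
    (·P-zeroʳ (β^ (s ∸ suc s)) (Y* V s (suc s)) (Y*-zero (V s (suc s)) (V-vanishes s (suc s) (ℕP.n<1+n s))))
    (·P-zeroˡ [ s ∸ s ]β (Y* Y* V s s) (K.reflexive (PE.cong [_]β (ℕP.n∸n≡0 s))))

  ⟦W-1-0⟧ : ∀ j → ⟦ W 1 j 0 ⟧ ≈ ι (β^ j)
  ⟦W-1-0⟧ zero = trans ⟦1P⟧ (sym ι-1)
  ⟦W-1-0⟧ (suc j) = begin
    ⟦ β^ 1 ·P W 1 j 0 +P Y* ([ 2 ]β ·P []) ⟧     ≈⟨ ⟦+P⟧ (β^ 1 ·P W 1 j 0) (Y* ([ 2 ]β ·P [])) ⟩
    ⟦ β^ 1 ·P W 1 j 0 ⟧ + ⟦ Y* ([ 2 ]β ·P []) ⟧  ≈⟨ +-cong (⟦·P⟧ (β^ 1) (W 1 j 0)) (trans (⟦Y*⟧ []) (zeroʳ y)) ⟩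
    β^ 1 · ⟦ W 1 j 0 ⟧ + 0#                      ≈⟨ +-identityʳ _ ⟩
    β^ 1 · ⟦ W 1 j 0 ⟧                           ≈⟨ *-congˡ (⟦W-1-0⟧ j) ⟩
    ι (β^ 1) * ι (β^ j)                          ≈⟨ sym (ι-* _ _) ⟩
    ι (β^ 1 K.* β^ j)                            ≈⟨ ι-cong (K.*-congʳ (K.*-identityʳ β)) ⟩
    ι (β^ (suc j))                               ∎

  ⟦W-1-1⟧ : ∀ j → ⟦ W 1 j 1 ⟧ ≈ [ j ]β · y
  ⟦W-1-1⟧ zero = sym (·-zeroˡ y)
  ⟦W-1-1⟧ (suc j) = begin
    ⟦ β^ 0 ·P W 1 j 1 +P Y* ([ 1 ]β ·P W 1 j 0) ⟧     ≈⟨ ⟦+P⟧ (β^ 0 ·P W 1 j 1) (Y* ([ 1 ]β ·P W 1 j 0)) ⟩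
    ⟦ β^ 0 ·P W 1 j 1 ⟧ + ⟦ Y* ([ 1 ]β ·P W 1 j 0) ⟧
      ≈⟨ +-cong (⟦·P⟧ (β^ 0) (W 1 j 1)) (trans (⟦Y*⟧ ([ 1 ]β ·P W 1 j 0)) (*-congˡ (⟦·P⟧ [ 1 ]β (W 1 j 0)))) ⟩
    K.1# · ⟦ W 1 j 1 ⟧ + y * ([ 1 ]β · ⟦ W 1 j 0 ⟧)   ≈⟨ +-cong (trans (·-identityˡ _) (⟦W-1-1⟧ j)) (*-congˡ (*-congˡ (⟦W-1-0⟧ j))) ⟩
    [ j ]β · y + y * (ι [ 1 ]β * ι (β^ j))            ≈⟨ +-congˡ (trans (*-congˡ (sym (ι-* _ _))) (sym (ι-central _ y))) ⟩
    [ j ]β · y + ([ 1 ]β K.* β^ j) · y                ≈⟨ ·-distribʳ _ _ y ⟩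
    ([ j ]β K.+ [ 1 ]β K.* β^ j) · y
      ≈⟨ ·-congʳ y (K.+-congˡ (K.trans (K.*-congʳ (K.+-identityˡ K.1#)) (K.*-identityˡ _))) ⟩
    [ suc j ]β · y                                    ∎

  -- the coefficients produced by diag-*-xyz for n = m = t = 1 obey the recursion defining V
  ⟦y*convW-1⟧ : ∀ s l → ⟦ Ypow 1 *P convW 1 s (V s) l ⟧ ≈ ⟦ V (suc s) l ⟧
  ⟦y*convW-1⟧ s l = trans (⟦*P⟧ (Ypow 1) (convW 1 s (V s) l)) (trans (*-congʳ (trans (⟦Ypow⟧ 1) (*-identityʳ y))) (step l))
    where
    step : ∀ l → y * ⟦ convW 1 s (V s) l ⟧ ≈ ⟦ V (suc s) l ⟧
    step zero = begin
      y * ⟦ V s 0 *P W 1 s 0 ⟧                           ≈⟨ *-congˡ (trans (⟦*P⟧ (V s 0) (W 1 s 0)) (*-congˡ (⟦W-1-0⟧ s))) ⟩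
      y * (⟦ V s 0 ⟧ * ι (β^ s))                         ≈⟨ *-congˡ (sym (ι-central _ _)) ⟩
      y * (β^ s · ⟦ V s 0 ⟧)                             ≈⟨ ·-central _ _ _ ⟩
      β^ s · (y * ⟦ V s 0 ⟧)                             ≈⟨ sym (+-identityʳ _) ⟩
      β^ s · (y * ⟦ V s 0 ⟧) + 0#                        ≈⟨ +-cong (sym (trans (⟦·P⟧ (β^ s) (Y* V s 0)) (*-congˡ (⟦Y*⟧ (V s 0)))))
                                                              (sym (⟦⟧-zero ([ suc s ]β ·P Y* Y* []) (·P-zeroʳ [ suc s ]β (Y* Y* []) (Y*-zero (Y* []) (Y*-zero [] (≋-refl [])))))) ⟩
      ⟦ β^ s ·P Y* V s 0 ⟧ + ⟦ [ suc s ]β ·P Y* Y* [] ⟧  ≈⟨ sym (⟦+P⟧ (β^ s ·P Y* V s 0) ([ suc s ]β ·P Y* Y* [])) ⟩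
      ⟦ V (suc s) 0 ⟧                                    ∎
    step (suc l) = begin
      y * ⟦ V s (suc l) *P W 1 (s ∸ suc l) 0 +P V s l *P W 1 (s ∸ l) 1 ⟧
                                                         ≈⟨ *-congˡ (⟦+P⟧ (V s (suc l) *P W 1 (s ∸ suc l) 0) (V s l *P W 1 (s ∸ l) 1)) ⟩
      y * (⟦ V s (suc l) *P W 1 (s ∸ suc l) 0 ⟧ + ⟦ V s l *P W 1 (s ∸ l) 1 ⟧)
                                                         ≈⟨ *-congˡ (+-cong (trans (⟦*P⟧ (V s (suc l)) (W 1 (s ∸ suc l) 0)) (*-congˡ (⟦W-1-0⟧ (s ∸ suc l))))
                                                                            (trans (⟦*P⟧ (V s l) (W 1 (s ∸ l) 1)) (*-congˡ (⟦W-1-1⟧ (s ∸ l))))) ⟩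
      y * (⟦ V s (suc l) ⟧ * ι b + ⟦ V s l ⟧ * (q · y))  ≈⟨ distribˡ _ _ _ ⟩
      y * (⟦ V s (suc l) ⟧ * ι b) + y * (⟦ V s l ⟧ * (q · y))
                                                         ≈⟨ +-cong first second ⟩
      b · ⟦ Y* V s (suc l) ⟧ + q · ⟦ Y* Y* V s l ⟧       ≈⟨ sym (+-cong (⟦·P⟧ b (Y* V s (suc l))) (⟦·P⟧ q (Y* Y* V s l))) ⟩
      ⟦ b ·P Y* V s (suc l) ⟧ + ⟦ q ·P Y* Y* V s l ⟧     ≈⟨ sym (⟦+P⟧ (b ·P Y* V s (suc l)) (q ·P Y* Y* V s l)) ⟩
      ⟦ V (suc s) (suc l) ⟧                              ∎
      where
      b = β^ (s ∸ suc l)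
      q = [ s ∸ l ]β
      first : y * (⟦ V s (suc l) ⟧ * ι b) ≈ b · ⟦ Y* V s (suc l) ⟧
      first = trans (*-congˡ (sym (ι-central _ _))) (trans (·-central _ _ _) (*-congˡ (sym (⟦Y*⟧ (V s (suc l))))))
      second : y * (⟦ V s l ⟧ * (q · y)) ≈ q · ⟦ Y* Y* V s l ⟧
      second = begin
        y * (⟦ V s l ⟧ * (q · y))   ≈⟨ *-congˡ (·-central q _ _) ⟩
        y * (q · (⟦ V s l ⟧ * y))   ≈⟨ ·-central q _ _ ⟩
        q · (y * (⟦ V s l ⟧ * y))   ≈⟨ *-congˡ (*-congˡ (trans (⟦⟧y≈y⟦⟧ (V s l)) (sym (⟦Y*⟧ (V s l))))) ⟩
        q · (y * ⟦ Y* V s l ⟧)      ≈⟨ *-congˡ (sym (⟦Y*⟧ (Y* V s l))) ⟩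
        q · ⟦ Y* Y* V s l ⟧         ∎

  diag-idem : ∀ s F → diag s s F ≡ Σ< (suc s) (λ l → xPz (s ∸ l) (F l) (s ∸ l))
  diag-idem s F = PE.cong (λ b → Σ< (suc b) (λ l → xPz (s ∸ l) (F l) (s ∸ l))) (ℕP.⊓-idem s)

  VExp-V : ∀ s → VExp s (V s)
  VExp-V zero = sym (trans (diag-single₀ 0 0) (*-identityˡ 1#))
  VExp-V (suc s) = begin
    (x * y * z) ^ suc s                                 ≈⟨ ^-sucʳ _ s ⟩
    (x * y * z) ^ s * (x * y * z)                       ≈⟨ *-cong (trans (VExp-V s) (≡⇒≈ (PE.sym (diag-idem s (V s)))))
                                                                  (*-cong (*-cong (sym (*-identityʳ x)) (sym (*-identityʳ y))) (sym (*-identityʳ z))) ⟩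
    diag s s (V s) * (x ^ 1 * y ^ 1 * z ^ 1)
      ≈⟨ diag-*-xyz s s 1 1 1 (V s) (λ l above → V-vanishes s l (PE.subst (_< l) (ℕP.⊓-idem s) above)) ⟩
    diag (s ℕ.+ 1) (s ℕ.+ 1) G                          ≡⟨ PE.trans (PE.cong (λ b → diag b b G) (ℕP.+-comm s 1)) (diag-idem (suc s) G) ⟩
    Σ< (suc (suc s)) (λ l → xPz (suc s ∸ l) (G l) (suc s ∸ l))
                                                        ≈⟨ Σ<-cong′ (suc (suc s)) (λ l → *-congᵐ (⟦y*convW-1⟧ s l)) ⟩
    Σ< (suc (suc s)) (λ l → xPz (suc s ∸ l) (V (suc s) l) (suc s ∸ l)) ∎
    where
    G : ℕ → Poly
    G l = Ypow 1 *P convW 1 s (V s) l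

  Part3-V : Part3
  Part3-V = V
          , VExp-V
          , (λ s F F-exp l l≤s → diag-unique s s F (V s)
               (trans (≡⇒≈ (diag-idem s F)) (trans (sym F-exp) (trans (VExp-V s) (≡⇒≈ (PE.sym (diag-idem s (V s)))))))
               l (PE.subst (l ≤_) (PE.sym (ℕP.⊓-idem s)) l≤s))
          , V-vanishes
          , V-1-0
          , (λ { (suc zero) _ → V-diagonal 0 ; (suc (suc l)) _ → V-vanishes 1 (suc (suc l)) (s≤s (s≤s z≤n)) })
          , (λ s l _ l≤s → PE.subst (λ j → V (suc s) l ≋ β^ (s ∸ l) ·P Y* V s l +P [ j ]β ·P Y* Y* prev (V s) l)
                                     (PE.trans (ℕP.+-∸-assoc 1 l≤s) (ℕP.+-comm 1 (s ∸ l))) (≋-refl (V (suc s) l)))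
          , (λ s _ → V-diagonal s)
    where
    V-1-0 : V 1 0 ≋ Yp
    V-1-0 zero = K.trans (K.+-cong (K.zeroʳ _) (K.zeroʳ _)) (K.+-identityʳ _)
    V-1-0 (suc zero) = K.trans (K.+-cong (K.*-identityʳ _) (K.zeroʳ _)) (K.+-identityʳ _)
    V-1-0 (suc (suc j)) = K.refl

  -- Powers of x + z

  E : ℕ → ℕ → ℕ → Poly
  E zero i k = single₀ (i ℕ.+ k)
  E (suc n) i k = prev (E n i) k +P β^ k ·P prev (λ i′ → E n i′ k) i +P Y* ([ k ℕ.+ 1 ]β ·P E n i (suc k))

  E-vanishes : ∀ n i k → n < i ℕ.+ k → E n i k ≋ 0P
  E-vanishes zero i k 0<i+k = single₀-suc (i ℕ.+ k) 0<i+k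
  E-vanishes (suc n) i k 1+n<i+k = +P-zero (prev (E n i) k +P β^ k ·P prev (λ i′ → E n i′ k) i) _
    (+P-zero (prev (E n i) k) (β^ k ·P prev (λ i′ → E n i′ k) i) (shiftedᵏ k 1+n<i+k) (·P-zeroʳ (β^ k) (prev (λ i′ → E n i′ k) i) (shiftedⁱ i 1+n<i+k)))
    (Y*-zero _ (·P-zeroʳ _ (E n i (suc k)) (E-vanishes n i (suc k)
      (ℕP.<-trans (ℕP.n<1+n n) (ℕP.<-≤-trans 1+n<i+k (ℕP.+-monoʳ-≤ i (ℕP.n≤1+n k)))))))
    where
    shiftedᵏ : ∀ k → suc n < i ℕ.+ k → prev (E n i) k ≋ 0P
    shiftedᵏ zero _ = ≋-refl 0P
    shiftedᵏ (suc k) 1+n<i+1+k = E-vanishes n i k (ℕP.≤-pred (PE.subst (suc n <_) (ℕP.+-suc i k) 1+n<i+1+k))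
    shiftedⁱ : ∀ i → suc n < i ℕ.+ k → prev (λ i′ → E n i′ k) i ≋ 0P
    shiftedⁱ zero _ = ≋-refl 0P
    shiftedⁱ (suc i) 1+n<1+i+k = E-vanishes n i k (ℕP.≤-pred 1+n<1+i+k)

  E-vanishesOutside : ∀ n → VanishesOutside (suc n) (E n)
  E-vanishesOutside n i k (inj₁ n<i) = E-vanishes n i k (ℕP.<-≤-trans n<i (ℕP.m≤m+n i k))
  E-vanishesOutside n i k (inj₂ n<k) = E-vanishes n i k (ℕP.<-≤-trans n<k (ℕP.m≤n+m k i))

  tri≈square : ∀ n F → (∀ i k → n < i ℕ.+ k → F i k ≋ 0P) → tri n F ≈ square (suc n) F
  tri≈square n F F≋0 = Σ<-cong (suc n) (λ i i<1+n → sym (Σ<-truncate (suc (n ∸ i)) (suc n) (s≤s (ℕP.m∸n≤m n i))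
    (λ k n∸i<k _ → xPz-zero i k (F i k) (F≋0 i k (PE.subst (_< i ℕ.+ k) (ℕP.m+[n∸m]≡n (ℕP.≤-pred i<1+n)) (ℕP.+-monoʳ-< i n∸i<k))))))

  square-+P : ∀ N F G → square N (λ i k → F i k +P G i k) ≈ square N F + square N G
  square-+P N F G = trans (Σ<-cong′ N (λ i → trans (Σ<-cong′ N (λ k → xPz-+P i k (F i k) (G i k))) (Σ<-distrib-+ N _ _)))
                          (Σ<-distrib-+ N _ _)

  square-*-z : ∀ n F → VanishesOutside (suc n) F → square (suc n) F * z ≈ square (suc (suc n)) (λ i k → prev (F i) k)
  square-*-z n F F≋0 = begin
    square N F * z                                           ≈⟨ trans (*-distribʳ-Σ< N z _) (Σ<-cong′ N (λ i → *-distribʳ-Σ< N z _)) ⟩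
    Σ< N (λ i → Σ< N (λ k → xPz i (F i k) k * z))            ≈⟨ Σ<-cong′ N (λ i → Σ<-cong′ N (λ k → xPz-*-z i (F i k) k)) ⟩
    Σ< N (λ i → Σ< N (λ k → xPz i (F i k) (suc k)))          ≈⟨ Σ<-cong′ N (λ i → Σ<-shift N (λ k → xPz i (prev (F i) k) k) (*-≈0ᵐ refl)) ⟩
    Σ< N (λ i → Σ< (suc N) (λ k → xPz i (prev (F i) k) k))   ≈⟨ sym (Σ<-truncate N (suc N) (ℕP.n≤1+n N)
                                                                  (λ i N≤i _ → Σ<-zero (suc N) (λ k _ → xPz-zero i k (prev (F i) k) (lastRow i k N≤i)))) ⟩
    square (suc N) (λ i k → prev (F i) k)                   ∎
    where
    N = suc n
    lastRow : ∀ i k → N ≤ i → prev (F i) k ≋ 0P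
    lastRow i zero _ = ≋-refl 0P
    lastRow i (suc k) N≤i = F≋0 i k (inj₁ N≤i)

  square-*-x : ∀ n F → VanishesOutside (suc n) F →
    square (suc n) F * x ≈ square (suc (suc n)) (λ i k → β^ k ·P prev (λ i′ → F i′ k) i)
                         + square (suc (suc n)) (λ i k → Y* ([ k ℕ.+ 1 ]β ·P F i (suc k)))
  square-*-x n F F≋0 = begin
    square N F * x                                           ≈⟨ trans (*-distribʳ-Σ< N x _) (Σ<-cong′ N (λ i → *-distribʳ-Σ< N x _)) ⟩
    Σ< N (λ i → Σ< N (λ k → xPz i (F i k) k * x))
      ≈⟨ Σ<-cong′ N (λ i → trans (Σ<-cong′ N (λ k → xPz-*-x i (F i k) k)) (Σ<-distrib-+ N _ _)) ⟩
    Σ< N (λ i → Σ< N (λ k → xPz (suc i) (P i k) k) + Σ< N (λ k → xPz i (Q i k) (k ∸ 1)))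
                                                             ≈⟨ Σ<-distrib-+ N _ _ ⟩
    Σ< N (λ i → Σ< N (λ k → xPz (suc i) (P i k) k)) + Σ< N (λ i → Σ< N (λ k → xPz i (Q i k) (k ∸ 1)))
                                                             ≈⟨ +-cong moveX lowerZ ⟩
    square (suc N) P′ + square (suc N) Q′                   ∎
    where
    N = suc n
    P Q : ℕ → ℕ → Poly
    P i k = β^ k ·P F i k
    Q i k = Y* ([ k ]β ·P F i k)
    P′ Q′ : ℕ → ℕ → Poly
    P′ i k = β^ k ·P prev (λ i′ → F i′ k) i
    Q′ i k = Y* ([ k ℕ.+ 1 ]β ·P F i (suc k))
    Q′≋0 : ∀ i k → n ≤ k → Q′ i k ≋ 0P
    Q′≋0 i k n≤k = Y*-zero _ (·P-zeroʳ _ (F i (suc k)) (F≋0 i (suc k) (inj₂ (s≤s n≤k))))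
    moveX : Σ< N (λ i → Σ< N (λ k → xPz (suc i) (P i k) k)) ≈ square (suc N) P′
    moveX = begin
      Σ< N (λ i → Σ< N (λ k → xPz (suc i) (P′ (suc i) k) k))
        ≈⟨ Σ<-shift N (λ i → Σ< N (λ k → xPz i (P′ i k) k)) (Σ<-zero N (λ k _ → *-≈0ᵐ refl)) ⟩
      Σ< (suc N) (λ i → Σ< N (λ k → xPz i (P′ i k) k))        ≈⟨ Σ<-cong′ (suc N) (λ i → sym (Σ<-truncate N (suc N) (ℕP.n≤1+n N)
                                                                    (λ k N≤k _ → xPz-zero i k (P′ i k) (lastColumn i k N≤k)))) ⟩
      square (suc N) P′                                       ∎
      where
      lastColumn : ∀ i k → N ≤ k → P′ i k ≋ 0P
      lastColumn zero k _ = ≋-refl 0P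
      lastColumn (suc i) k N≤k = ·P-zeroʳ (β^ k) (F i k) (F≋0 i k (inj₂ N≤k))
    lowerZ : Σ< N (λ i → Σ< N (λ k → xPz i (Q i k) (k ∸ 1))) ≈ square (suc N) Q′
    lowerZ = begin
      Σ< N (λ i → Σ< N (λ k → xPz i (Q i k) (k ∸ 1)))         ≈⟨ Σ<-cong′ N row ⟩
      Σ< N (λ i → Σ< (suc N) (λ k → xPz i (Q′ i k) k))        ≈⟨ sym (Σ<-truncate N (suc N) (ℕP.n≤1+n N)
                                                                    (λ i N≤i _ → Σ<-zero (suc N) (λ k _ → xPz-zero i k (Q′ i k)
                                                                       (Y*-zero _ (·P-zeroʳ _ (F i (suc k)) (F≋0 i (suc k) (inj₁ N≤i))))))) ⟩
      square (suc N) Q′                                       ∎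
      where
      row : ∀ i → Σ< N (λ k → xPz i (Q i k) (k ∸ 1)) ≈ Σ< (suc N) (λ k → xPz i (Q′ i k) k)
      row i = begin
        Σ< N (λ k → xPz i (Q i k) (k ∸ 1))                    ≈⟨ Σ<-head n _ ⟩
        xPz i (Q i 0) 0 + Σ< n (λ k → xPz i (Q i (suc k)) k)  ≈⟨ +-cong (xPz-zero i 0 (Q i 0) (Y*-zero _ (·P-zeroˡ [ 0 ]β (F i 0) K.refl)))
                                                                  (Σ<-cong′ n (λ k → ≡⇒≈ (PE.cong (λ j → xPz i (Y* ([ j ]β ·P F i (suc k))) k) (ℕP.+-comm 1 k)))) ⟩
        0# + Σ< n (λ k → xPz i (Q′ i k) k)                    ≈⟨ +-identityˡ _ ⟩
        Σ< n (λ k → xPz i (Q′ i k) k)                         ≈⟨ sym (Σ<-truncate n (suc N) (ℕP.≤-trans (ℕP.n≤1+n n) (ℕP.n≤1+n N))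
                                                                  (λ k n≤k _ → xPz-zero i k (Q′ i k) (Q′≋0 i k n≤k))) ⟩
        Σ< (suc N) (λ k → xPz i (Q′ i k) k)                   ∎

  EExp-E : ∀ n → EExp n (E n)
  EExp-E zero = sym (trans (+-identityˡ _) (trans (+-identityˡ _) (trans (*-identityʳ _) (trans (*-identityˡ _) ⟦1P⟧))))
  EExp-E (suc n) = begin
    (x + z) ^ suc n                                      ≈⟨ ^-sucʳ _ n ⟩
    (x + z) ^ n * (x + z)                                ≈⟨ *-congʳ (trans (EExp-E n) (tri≈square n (E n) (E-vanishes n))) ⟩
    square (suc n) (E n) * (x + z)                       ≈⟨ distribˡ _ _ _ ⟩
    square (suc n) (E n) * x + square (suc n) (E n) * z
      ≈⟨ +-cong (square-*-x n (E n) (E-vanishesOutside n)) (square-*-z n (E n) (E-vanishesOutside n)) ⟩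
    (square N P₂ + square N P₃) + square N P₁            ≈⟨ trans (+-comm _ _) (sym (+-assoc _ _ _)) ⟩
    (square N P₁ + square N P₂) + square N P₃
      ≈⟨ sym (trans (square-+P N (λ i k → P₁ i k +P P₂ i k) P₃) (+-congʳ (square-+P N P₁ P₂))) ⟩
    square N (E (suc n))                                 ≈⟨ sym (tri≈square (suc n) (E (suc n)) (E-vanishes (suc n))) ⟩
    tri (suc n) (E (suc n))                              ∎
    where
    N = suc (suc n)
    P₁ P₂ P₃ : ℕ → ℕ → Poly
    P₁ i k = prev (E n i) k
    P₂ i k = β^ k ·P prev (λ i′ → E n i′ k) i
    P₃ i k = Y* ([ k ℕ.+ 1 ]β ·P E n i (suc k))

  Part5-E : Part5
  Part5-E = binomial xy≈yx
          , binomial yz≈zy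
          , E
          , EExp-E
          , (λ n F F-exp → tri-unique n F (E n) (trans (sym F-exp) (EExp-E n)))
          , E-vanishes
          , ≋-refl 1P
          , (λ n i k → ≋-refl (E (suc n) i k))

  claim : Claim
  claim = ((λ m n → ^-commute-^ n m (sym xy≈yx)) , (λ m n → ^-commute-^ n m (sym yz≈zy)) , explicit)
        , (W , WProps-W , Part2-Rf , Part4-Rf)
        , Part3-V
        , Part5-E

proposition3p4 : ∀ {c ℓ a ℓa} (K : CommutativeRing c ℓ) → IsField K → CharZero K →
    (R : Ring a ℓa) (alg : AlgebraStr K R) (β : CommutativeRing.Carrier K) →
    ¬ (CommutativeRing._≈_ K β (CommutativeRing.0# K)) →
    (x y z : Ring.Carrier R) → Theory.IsA alg β x y z → Theory.Claim alg β x y z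
proposition3p4 K _ _ R alg β _ x y z isA = Expansions.claim alg β x y z isA
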